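{- Let $n\geq 3$, let $M_0$ be a simple matroid on a ground set $E_0$ disjoint from $[n]$, fix $\epsilon_0\in E_0$, and let $M=C_n\oplus M_0$ on $E=[n]\cup E_0$ and $M'=P^n_{\epsilon_0}\oplus S$ on $\bar E\cup\{p\}$. Let $\phi:A(M)\to A(M')$ be the graded algebra homomorphism induced by the exterior algebra homomorphism $\hat\phi$ with $\hat\phi(e_i)=\bar e_i-\bar e_n+e_p$ for $i\in[n-1]$, $\hat\phi(e_n)=e_p$, and $\hat\phi(e_\epsilon)=\bar e_\epsilon$ for $\epsilon\in E_0$. Then $\phi$ is an isomorphism.
   Context: For a finite set $E$, $\Lambda(E)$ is the exterior algebra over a fixed commutative ring $K$ generated by degree-one elements $e_i$, $i\in E$; $\partial$ is the $K$-linear map with $\partial(e_{i_1}\cdots e_{i_k})=\sum_{j=1}^k(-1)^{j-1}e_{i_1}\cdots\widehat{e_{i_j}}\cdots e_{i_k}$; for a simple matroid $N$ on $E$, $I(N)$ is the ideal generated by $\partial(e_{i_1}\cdots e_{i_k})$ over circuits $\{i_1,\dots,i_k\}$ of $N$, and the Orlik–Solomon algebra is $A(N)=\Lambda(E)/I(N)$ (the map $\hat\phi$ sends $I(M)$ into $I(M')$, so $\phi$ is well defined). $C_n$ is the matroid on $[n]=\{1,\dots,n\}$ of rank $n-1$ whose only circuit is $[n]$; $S$ is the rank-one matroid on a single point $p$; $\oplus$ is direct sum. The parallel connection $P^n_{\epsilon_0}$: on $[n]\cup E_0$ identify $1$ with $\epsilon_0$ (other classes singletons), write $\bar q$ for the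 class of $q$, $\bar X$ for the set of classes of elements of $X$, $\bar E$ for the set of classes; $P^n_{\epsilon_0}$ is the matroid on $\bar E$ whose circuits are the $\bar C$ with $C$ a circuit of $C_n$ or of $M_0$, together with the sets $\overline{C-1}\cup\overline{C'-\epsilon_0}$ with $1\in C$ a circuit of $C_n$ and $\epsilon_0\in C'$ a circuit of $M_0$. The generator corresponding to $\bar\epsilon$ is written $\bar e_\epsilon$ (so $\bar e_1=\bar e_{\epsilon_0}$). -}

module Defs where

open import Level using (Level; _⊔_) renaming (zero to lzero; suc to lsuc)
open import Algebra.Bundles using (CommutativeRing)
open import Data.Nat using (ℕ; zero; suc; pred; _+_; _≤_)
open import Data.Fin using (Fin; zero; suc; _↑ˡ_; _↑ʳ_; fromℕ; splitAt)
open import Function using (_∘_)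
open import Data.Fin.Subset using (Subset; _∈_; _⊆_; _∪_; _-_; ⊥; ⊤; ⁅_⁆; ∣_∣)
open import Data.Vec using (Vec; []; _∷_; _++_)
open import Data.Bool using (Bool; true; false; T; if_then_else_)
open import Data.List using (List; []; _∷_; map; foldr)
open import Data.Product using (Σ; _×_; ∃) renaming (_,_ to _,ₚ_)
open import Data.Sum using (_⊎_; [_,_]′)
open import Data.Empty renaming (⊥ to Empty)
open import Relation.Nullary using (¬_; Dec)
open import Relation.Binary.PropositionalEquality using (_≡_)

record Matroid (k : ℕ) : Set₁ where
  field
    Circuit   : Subset k → Set
    circuit?  : (C : Subset k) → Dec (Circuit C)
    C1        : ¬ Circuit ⊥
    C2        : ∀ C D → Circuit C → Circuit D → C ⊆ D → C ≡ D
    C3        : ∀ C D → Circuit C → Circuit D → ¬ (C ≡ D) →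
                ∀ e → e ∈ C → e ∈ D →
                Σ (Subset k) λ F → Circuit F × F ⊆ ((C ∪ D) - e)

-- simple = no loops and no parallel elements = every circuit has size ≥ 3
record SimpleMatroid (k : ℕ) : Set₁ where
  field
    matroid : Matroid k
  open Matroid matroid public
  field
    simple  : ∀ C → Circuit C → 3 ≤ ∣ C ∣

image : ∀ {a b} → (Fin a → Fin b) → Subset a → Subset b
image {zero}  f []       = ⊥
image {suc a} f (x ∷ S)  = (if x then ⁅ f zero ⁆ else ⊥) ∪ image (λ i → f (suc i)) S

elems : ∀ {k} → Subset k → List (Fin k)
elems []            = []
elems (true  ∷ S)   = zero ∷ map suc (elems S)
elems (false ∷ S)   = map suc (elems S)

-- "1 ∈ C" and "C - 1" for subsets of [n] = Fin n (the element 1 is Fin.zero)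
has1 : ∀ {n} → Subset n → Set
has1 []      = Empty
has1 (x ∷ _) = T x

remove1 : ∀ {n} → Subset n → Subset n
remove1 []      = []
remove1 (_ ∷ S) = false ∷ S

-- The matroids of the statement.
-- [n] = Fin n, with the element i ∈ [n] being the (i-1)-th element of Fin n.
-- E = [n] ∪ E₀ = Fin (n + m): i ∈ [n] is  i ↑ˡ m,  ε ∈ E₀ is  n ↑ʳ ε;
-- a subset of E is  A ++ B  with A ⊆ [n], B ⊆ E₀.

CnCircuit : ∀ {n} → Subset n → Set
CnCircuit C = C ≡ ⊤

MCircuit : ∀ n {m} → SimpleMatroid m → Subset (n + m) → Set
MCircuit n {m} M₀ D =
    (Σ (Subset n) λ C → CnCircuit C × D ≡ C ++ ⊥)
  ⊎ (Σ (Subset m) λ C → SimpleMatroid.Circuit M₀ C × D ≡ ⊥ ++ C)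

-- The set of classes Ē = ([n] ∪ E₀)/(1 ∼ ε₀) is represented by Fin (pred n + m):
-- the class of i ∈ {2,…,n} is the (i-2)-th element of the first block,
-- the class of ε ∈ E₀ is  (pred n) ↑ʳ ε, and the class of 1 is that of ε₀.
cls : ∀ {n m} → Fin m → Fin (n + m) → Fin (pred n + m)
cls {zero}  ε₀ j       = j
cls {suc k} ε₀ zero    = k ↑ʳ ε₀
cls {suc k} ε₀ (suc j) = j

PCircuit : ∀ n {m} → SimpleMatroid m → Fin m → Subset (pred n + m) → Set
PCircuit n {m} M₀ ε₀ D =
    (Σ (Subset n) λ C → CnCircuit C × D ≡ image (cls {n} ε₀) (C ++ ⊥))
  ⊎ (Σ (Subset m) λ C → SimpleMatroid.Circuit M₀ C × D ≡ image (cls {n} ε₀) (⊥ ++ C))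
  ⊎ (Σ (Subset n) λ C → Σ (Subset m) λ C′ →
        CnCircuit C × has1 C × SimpleMatroid.Circuit M₀ C′ × ε₀ ∈ C′ ×
        D ≡ image (cls {n} ε₀) (remove1 C ++ ⊥) ∪ image (cls {n} ε₀) (⊥ ++ (C′ - ε₀)))

-- circuits of M′ = P^n_{ε₀} ⊕ S on Ē ∪ {p} = Fin (pred n + m + 1),
-- where p is the last element  (pred n + m) ↑ʳ zero.
-- S (a single non-loop point) has no circuits.
M′Circuit : ∀ n {m} → SimpleMatroid m → Fin m → Subset (pred n + m + 1) → Set
M′Circuit n M₀ ε₀ D =
  Σ (Subset _) λ C → PCircuit n M₀ ε₀ C × D ≡ C ++ (false ∷ [])

module Exterior {c ℓ} (K : CommutativeRing c ℓ) where
  open CommutativeRing K renaming (Carrier to R)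
    using (_≈_; 0#; 1#) renaming (_+_ to _+K_; _*_ to _*K_; -_ to -K_)

  -- Λ k = exterior algebra on generators e_i, i : Fin k.
  -- Λ 0 = K (as ⟨ r ⟩);  an element (x₀ , x₁) of Λ (suc k) stands for x₀ + e_zero · x₁,
  -- where x₀, x₁ lie in the exterior algebra on e_(suc i), i : Fin k.
  data Λ : ℕ → Set c where
    ⟨_⟩  : R → Λ zero
    _,_ : ∀ {k} → Λ k → Λ k → Λ (suc k)

  infix 4 _≈Λ_
  _≈Λ_ : ∀ {k} → Λ k → Λ k → Set ℓ
  _≈Λ_ ⟨ x ⟩ ⟨ y ⟩ = x ≈ y
  (x₀ , x₁) ≈Λ (y₀ , y₁) = (x₀ ≈Λ y₀) × (x₁ ≈Λ y₁)

  0Λ : ∀ {k} → Λ k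
  0Λ {zero}  = ⟨ 0# ⟩
  0Λ {suc k} = 0Λ , 0Λ

  1Λ : ∀ {k} → Λ k
  1Λ {zero}  = ⟨ 1# ⟩
  1Λ {suc k} = 1Λ , 0Λ

  infixl 6 _+Λ_ _-Λ_
  infixl 7 _*Λ_

  _+Λ_ : ∀ {k} → Λ k → Λ k → Λ k
  ⟨ x ⟩ +Λ ⟨ y ⟩ = ⟨ x +K y ⟩
  (x₀ , x₁) +Λ (y₀ , y₁) = (x₀ +Λ y₀) , (x₁ +Λ y₁)

  -Λ_ : ∀ {k} → Λ k → Λ k
  -Λ ⟨ x ⟩ = ⟨ -K x ⟩
  -Λ (x₀ , x₁) = (-Λ x₀) , (-Λ x₁)

  _-Λ_ : ∀ {k} → Λ k → Λ k → Λ k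
  x -Λ y = x +Λ (-Λ y)

  -- grade involution (−1)^deg
  ι : ∀ {k} → Λ k → Λ k
  ι ⟨ x ⟩ = ⟨ x ⟩
  ι (x₀ , x₁) = ι x₀ , (-Λ ι x₁)

  -- (x₀ + e₀x₁)(y₀ + e₀y₁) = x₀y₀ + e₀(ι(x₀)y₁ + x₁y₀)
  _*Λ_ : ∀ {k} → Λ k → Λ k → Λ k
  ⟨ x ⟩ *Λ ⟨ y ⟩ = ⟨ x *K y ⟩
  (x₀ , x₁) *Λ (y₀ , y₁) = (x₀ *Λ y₀) , ((ι x₀ *Λ y₁) +Λ (x₁ *Λ y₀))

  sc : ∀ {k} → R → Λ k
  sc {zero}  r = ⟨ r ⟩
  sc {suc k} r = sc r , 0Λ

  e : ∀ {k} → Fin k → Λ k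
  e {suc k} zero    = 0Λ , 1Λ
  e {suc k} (suc i) = e i , 0Λ

  prodE : ∀ {k} → List (Fin k) → Λ k
  prodE = foldr (λ i acc → e i *Λ acc) 1Λ

  -- ∂(e_{i₁}⋯e_{i_r}) = Σ_j (−1)^(j−1) e_{i₁}⋯ê_{i_j}⋯e_{i_r}
  deletions : ∀ {a} {A : Set a} → List A → List (List A)
  deletions []       = []
  deletions (x ∷ xs) = xs ∷ map (x ∷_) (deletions xs)

  altSum : ∀ {k} → List (Λ k) → Λ k
  altSum []       = 0Λ
  altSum (x ∷ xs) = x -Λ altSum xs

  ∂ : ∀ {k} → List (Fin k) → Λ k
  ∂ ws = altSum (map prodE (deletions ws))

  data InI {k} (Circ : Subset k → Set) : Λ k → Set (c ⊔ ℓ) where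
    gen  : ∀ C → Circ C → InI Circ (∂ (elems C))
    zro  : InI Circ 0Λ
    add  : ∀ {x y} → InI Circ x → InI Circ y → InI Circ (x +Λ y)
    mulˡ : ∀ a {x} → InI Circ x → InI Circ (a *Λ x)
    mulʳ : ∀ a {x} → InI Circ x → InI Circ (x *Λ a)
    resp : ∀ {x y} → x ≈Λ y → InI Circ x → InI Circ y

  -- equality in A(N) = Λ / I(N)
  _≡A[_]_ : ∀ {k} → Λ k → (Subset k → Set) → Λ k → Set (c ⊔ ℓ)
  x ≡A[ Circ ] y = InI Circ (x -Λ y)

  extend : ∀ {a b} → (Fin a → Λ b) → Λ a → Λ b
  extend {zero}  g ⟨ r ⟩ = sc r
  extend {suc a} g (x₀ , x₁) =
    extend (λ i → g (suc i)) x₀ +Λ (g zero *Λ extend (λ i → g (suc i)) x₁)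

  -- φ̂ on generators.  Target ground set Fin (pred n + m + 1):
  -- ē_q = e (q ↑ˡ 1) for q ∈ Ē, and e_p = e ((pred n + m) ↑ʳ zero).
  module _ {n m : ℕ} (ε₀ : Fin m) where
    ē : Fin (pred n + m) → Λ (pred n + m + 1)
    ē q = e (q ↑ˡ 1)

    eₚ : Λ (pred n + m + 1)
    eₚ = e ((pred n + m) ↑ʳ zero)

    isLast : ∀ {r} → Fin r → Bool
    isLast {suc zero}    zero    = true
    isLast {suc (suc r)} zero    = false
    isLast {suc r}       (suc i) = isLast i

    lastOf : ∀ {r} → Fin r → Fin r
    lastOf {suc r} _ = fromℕ r

    φgen : Fin n → Λ (pred n + m + 1)
    φgen i = if isLast i then eₚ
             else (ē (cls {n} ε₀ (i ↑ˡ m)) -Λ ē (cls {n} ε₀ ((lastOf i) ↑ˡ m)) +Λ eₚ)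

    φ̂gen : Fin (n + m) → Λ (pred n + m + 1)
    φ̂gen = [ φgen , (λ ε → ē (cls {n} ε₀ (n ↑ʳ ε))) ]′ ∘ splitAt n

    φ̂ : Λ (n + m) → Λ (pred n + m + 1)
    φ̂ = extend φ̂gen

  -- φ : A(M) → A(M′) is a well-defined isomorphism (bijection of quotients)
  IsIsoOS : ∀ {a b} → (Subset a → Set) → (Subset b → Set) → (Λ a → Λ b) → Set (c ⊔ ℓ)
  IsIsoOS CircM CircM′ f =
      (∀ x y → x ≡A[ CircM ] y → f x ≡A[ CircM′ ] f y)
    × (∀ x y → f x ≡A[ CircM′ ] f y → x ≡A[ CircM ] y)
    × (∀ y → Σ (Λ _) λ x → f x ≡A[ CircM′ ] y)

{-# OPTIONS --safe #-}
module Submission where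

-- φ̂ is a substitution of degree-one elements with inverse ψ̂ : ē_j ↦ e_j − e_1 + e_{ε₀} (2 ≤ j ≤ n),
-- ē_ε ↦ e_ε (ε ∈ E₀), e_p ↦ e_n, so it suffices that each maps the generators ∂e_C of one
-- Orlik–Solomon ideal into the other. All generators involved are affine (∂u = 1), and for these
-- ∂(u₁ ⋯ u_r w) = ± ∏ (u_i − w): up to sign, ∂ of such a product is unchanged by a common
-- translation of the factors and by reordering them. On [n], φ̂ and ψ̂ are common translations of
-- the bijection between [n] and its classes, which settles the circuit [n] and its image in
-- P^n_{ε₀}; circuits inside E₀ are fixed. For a joined circuit {2,…,n} ∪ (C′ − ε₀), ψ̂ yields
-- ∂(P Q) with P = ∏_j (e_j − e_1 + e_{ε₀}); as P e_{ε₀} = B e_{ε₀} where B = ∏_j (e_j − e_1) is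
-- ±∂e_[n], and Q − e_{ε₀} ∂Q is ±∂e_{C′}, P Q lies in I(M), and ∂ preserves I(M).

open import Defs
open import Algebra.Bundles using (CommutativeRing)
open import Data.Nat using (ℕ; _≤_; s≤s)
open import Data.Fin using (Fin)

module AbelianGroupSolver where
  open import Algebra.Bundles using (AbelianGroup)
  open import Data.Bool using (Bool; true; T; _∧_)
  open import Data.Fin using (zero; suc)
  open import Data.Nat using (suc; _+_; _≡ᵇ_)
  open import Data.Nat.Properties using (≡ᵇ⇒≡)
  open import Data.Product using (_×_; _,_)
  open import Data.Unit using (tt)
  open import Data.Vec using (Vec; []; _∷_; lookup; replicate; zipWith; map)
  import Relation.Binary.PropositionalEquality as ≡

  infixl 6 _⊕_ _⊖_
  infix 7 ⊝_

  data Expr (n : ℕ) : Set where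
    var : Fin n → Expr n
    _⊕_ : Expr n → Expr n → Expr n
    ⊝_  : Expr n → Expr n

  _⊖_ : ∀ {n} → Expr n → Expr n → Expr n
  x ⊖ y = x ⊕ ⊝ y

  -- A coefficient (p , q) stands for the integer p − q.
  Coefficient : Set
  Coefficient = ℕ × ℕ

  _+ᶜ_ : Coefficient → Coefficient → Coefficient
  (p , q) +ᶜ (p′ , q′) = (p + p′ , q + q′)

  -ᶜ_ : Coefficient → Coefficient
  -ᶜ (p , q) = (q , p)

  _≟ᶜ_ : Coefficient → Coefficient → Bool
  (p , q) ≟ᶜ (p′ , q′) = (p + q′) ≡ᵇ (p′ + q)

  Normal : ℕ → Set
  Normal = Vec Coefficient

  normalise : ∀ {n} → Expr n → Normal n
  normalise (var i) = unit i
    where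
    unit : ∀ {n} → Fin n → Normal n
    unit zero    = (1 , 0) ∷ replicate _ (0 , 0)
    unit (suc i) = (0 , 0) ∷ unit i
  normalise (x ⊕ y) = zipWith _+ᶜ_ (normalise x) (normalise y)
  normalise (⊝ x)   = map -ᶜ_ (normalise x)

  _≟ₙ_ : ∀ {n} → Normal n → Normal n → Bool
  []       ≟ₙ []       = true
  (c ∷ cs) ≟ₙ (d ∷ ds) = (c ≟ᶜ d) ∧ (cs ≟ₙ ds)

  v₀ : ∀ {n} → Expr (suc n)
  v₀ = var zero

  v₁ : ∀ {n} → Expr (suc (suc n))
  v₁ = var (suc zero)

  v₂ : ∀ {n} → Expr (suc (suc (suc n)))
  v₂ = var (suc (suc zero))

  v₃ : ∀ {n} → Expr (suc (suc (suc (suc n))))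
  v₃ = var (suc (suc (suc zero)))

  v₄ : ∀ {n} → Expr (suc (suc (suc (suc (suc n)))))
  v₄ = var (suc (suc (suc (suc zero))))

  module Solve {a ℓ} (G : AbelianGroup a ℓ) where
    open AbelianGroup G
    open import Algebra.Properties.AbelianGroup G using (⁻¹-∙-comm)
    open import Algebra.Properties.Group group using (ε⁻¹≈ε; ⁻¹-involutive)
    open import Algebra.Properties.CommutativeSemigroup commutativeSemigroup using (interchange)
    open import Algebra.Properties.Monoid.Mult monoid using (×-homo-+; ×-homo-1; ×-congˡ) renaming (_×_ to _·_)
    open import Relation.Binary.Reasoning.Setoid setoid

    ⟦_⟧ : ∀ {n} → Expr n → Vec Carrier n → Carrier
    ⟦ var i ⟧ ρ = lookup ρ i
    ⟦ x ⊕ y ⟧ ρ = ⟦ x ⟧ ρ ∙ ⟦ y ⟧ ρ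
    ⟦ ⊝ x ⟧   ρ = ⟦ x ⟧ ρ ⁻¹

    private
      ⟦_⟧ᶜ : Coefficient → Carrier → Carrier
      ⟦ p , q ⟧ᶜ x = (p · x) ∙ (q · x) ⁻¹

      ⟦_⟧ₙ : ∀ {n} → Normal n → Vec Carrier n → Carrier
      ⟦ [] ⟧ₙ     []      = ε
      ⟦ c ∷ cs ⟧ₙ (x ∷ ρ) = ⟦ c ⟧ᶜ x ∙ ⟦ cs ⟧ₙ ρ

      ⟦0⟧ᶜ : ∀ x → ⟦ 0 , 0 ⟧ᶜ x ≈ ε
      ⟦0⟧ᶜ x = trans (identityˡ _) ε⁻¹≈ε

      ⟦0⟧ₙ : ∀ {n} (ρ : Vec Carrier n) → ⟦ replicate n (0 , 0) ⟧ₙ ρ ≈ ε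
      ⟦0⟧ₙ []      = refl
      ⟦0⟧ₙ (x ∷ ρ) = trans (∙-cong (⟦0⟧ᶜ x) (⟦0⟧ₙ ρ)) (identityˡ ε)

      ⟦var⟧ : ∀ {n} (i : Fin n) ρ → ⟦ normalise (var i) ⟧ₙ ρ ≈ lookup ρ i
      ⟦var⟧ zero    (x ∷ ρ) = trans (∙-cong (trans (∙-cong (×-homo-1 x) ε⁻¹≈ε) (identityʳ x)) (⟦0⟧ₙ ρ)) (identityʳ x)
      ⟦var⟧ (suc i) (x ∷ ρ) = trans (∙-cong (⟦0⟧ᶜ x) (⟦var⟧ i ρ)) (identityˡ _)

      ⟦+ᶜ⟧ : ∀ c d x → ⟦ c +ᶜ d ⟧ᶜ x ≈ ⟦ c ⟧ᶜ x ∙ ⟦ d ⟧ᶜ x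
      ⟦+ᶜ⟧ (p , q) (p′ , q′) x = begin
        ((p + p′) · x) ∙ ((q + q′) · x) ⁻¹                ≈⟨ ∙-cong (×-homo-+ x p p′) (⁻¹-cong (×-homo-+ x q q′)) ⟩
        ((p · x) ∙ (p′ · x)) ∙ ((q · x) ∙ (q′ · x)) ⁻¹    ≈⟨ ∙-congˡ (⁻¹-∙-comm _ _) ⟨
        ((p · x) ∙ (p′ · x)) ∙ ((q · x) ⁻¹ ∙ (q′ · x) ⁻¹) ≈⟨ interchange _ _ _ _ ⟩
        ((p · x) ∙ (q · x) ⁻¹) ∙ ((p′ · x) ∙ (q′ · x) ⁻¹) ∎

      ⟦-ᶜ⟧ : ∀ c x → ⟦ -ᶜ c ⟧ᶜ x ≈ ⟦ c ⟧ᶜ x ⁻¹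
      ⟦-ᶜ⟧ (p , q) x = begin
        (q · x) ∙ (p · x) ⁻¹        ≈⟨ comm _ _ ⟩
        (p · x) ⁻¹ ∙ (q · x)        ≈⟨ ∙-congˡ (⁻¹-involutive _) ⟨
        (p · x) ⁻¹ ∙ (q · x) ⁻¹ ⁻¹  ≈⟨ ⁻¹-∙-comm _ _ ⟩
        ((p · x) ∙ (q · x) ⁻¹) ⁻¹   ∎

      ⟦zipWith⟧ : ∀ {n} (cs ds : Normal n) ρ → ⟦ zipWith _+ᶜ_ cs ds ⟧ₙ ρ ≈ ⟦ cs ⟧ₙ ρ ∙ ⟦ ds ⟧ₙ ρ
      ⟦zipWith⟧ []       []       []      = sym (identityˡ ε)
      ⟦zipWith⟧ (c ∷ cs) (d ∷ ds) (x ∷ ρ) = trans (∙-cong (⟦+ᶜ⟧ c d x) (⟦zipWith⟧ cs ds ρ)) (interchange _ _ _ _)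

      ⟦map⟧ : ∀ {n} (cs : Normal n) ρ → ⟦ map -ᶜ_ cs ⟧ₙ ρ ≈ ⟦ cs ⟧ₙ ρ ⁻¹
      ⟦map⟧ []       []      = sym ε⁻¹≈ε
      ⟦map⟧ (c ∷ cs) (x ∷ ρ) = trans (∙-cong (⟦-ᶜ⟧ c x) (⟦map⟧ cs ρ)) (⁻¹-∙-comm _ _)

      normalise-correct : ∀ {n} (x : Expr n) ρ → ⟦ normalise x ⟧ₙ ρ ≈ ⟦ x ⟧ ρ
      normalise-correct (var i) ρ = ⟦var⟧ i ρ
      normalise-correct (x ⊕ y) ρ = trans (⟦zipWith⟧ (normalise x) (normalise y) ρ) (∙-cong (normalise-correct x ρ) (normalise-correct y ρ))
      normalise-correct (⊝ x)   ρ = trans (⟦map⟧ (normalise x) ρ) (⁻¹-cong (normalise-correct x ρ))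

      -- p − q = p′ − q′ follows from p + q′ = p′ + q by adding q + q′ to both sides.
      cross : ∀ a b c d → a ∙ d ≈ c ∙ b → a ∙ b ⁻¹ ≈ c ∙ d ⁻¹
      cross a b c d a+d≈c+b = begin
        a ∙ b ⁻¹                ≈⟨ identityʳ _ ⟨
        (a ∙ b ⁻¹) ∙ ε          ≈⟨ ∙-congˡ (inverseʳ d) ⟨
        (a ∙ b ⁻¹) ∙ (d ∙ d ⁻¹) ≈⟨ interchange _ _ _ _ ⟩
        (a ∙ d) ∙ (b ⁻¹ ∙ d ⁻¹) ≈⟨ ∙-cong a+d≈c+b (comm _ _) ⟩
        (c ∙ b) ∙ (d ⁻¹ ∙ b ⁻¹) ≈⟨ interchange _ _ _ _ ⟩
        (c ∙ d ⁻¹) ∙ (b ∙ b ⁻¹) ≈⟨ ∙-congˡ (inverseʳ b) ⟩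
        (c ∙ d ⁻¹) ∙ ε          ≈⟨ identityʳ _ ⟩
        c ∙ d ⁻¹                ∎

      ≟ᶜ-sound : ∀ c d x → T (c ≟ᶜ d) → ⟦ c ⟧ᶜ x ≈ ⟦ d ⟧ᶜ x
      ≟ᶜ-sound (p , q) (p′ , q′) x eq = cross _ _ _ _ (begin
        (p · x) ∙ (q′ · x) ≈⟨ ×-homo-+ x p q′ ⟨
        (p + q′) · x       ≈⟨ ×-congˡ (≡ᵇ⇒≡ (p + q′) (p′ + q) eq) ⟩
        (p′ + q) · x       ≈⟨ ×-homo-+ x p′ q ⟩
        (p′ · x) ∙ (q · x) ∎)

      ≟ₙ-sound : ∀ {n} (cs ds : Normal n) ρ → T (cs ≟ₙ ds) → ⟦ cs ⟧ₙ ρ ≈ ⟦ ds ⟧ₙ ρ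
      ≟ₙ-sound []       []       []      _  = refl
      ≟ₙ-sound (c ∷ cs) (d ∷ ds) (x ∷ ρ) eq with c ≟ᶜ d in c≟d
      ... | true = ∙-cong (≟ᶜ-sound c d x (≡.subst T (≡.sym c≟d) tt)) (≟ₙ-sound cs ds ρ eq)

    solve : ∀ {n} (lhs rhs : Expr n) (ρ : Vec Carrier n) {_ : T (normalise lhs ≟ₙ normalise rhs)} →
            ⟦ lhs ⟧ ρ ≈ ⟦ rhs ⟧ ρ
    solve lhs rhs ρ {eq} = begin
      ⟦ lhs ⟧ ρ            ≈⟨ normalise-correct lhs ρ ⟨
      ⟦ normalise lhs ⟧ₙ ρ ≈⟨ ≟ₙ-sound (normalise lhs) (normalise rhs) ρ eq ⟩
      ⟦ normalise rhs ⟧ₙ ρ ≈⟨ normalise-correct rhs ρ ⟩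
      ⟦ rhs ⟧ ρ            ∎

module ExteriorRing {c ℓ} (K : CommutativeRing c ℓ) where
  open import Level using (_⊔_)
  open import Algebra.Bundles using (Ring; RawRing)
  open import Algebra.Structures using (IsRing)
  open import Algebra.Morphism.Structures using (IsRingMonomorphism)
  import Algebra.Morphism.RingMonomorphism as RingMonomorphism
  import Algebra.Properties.Ring as RingProperties
  import Algebra.Properties.AbelianGroup as AbelianGroupProperties
  import Algebra.Properties.CommutativeSemigroup as CommutativeSemigroupProperties
  import Relation.Binary.Reasoning.Setoid as SetoidReasoning
  open import Data.Nat using (zero; suc)
  open import Data.Product using (_,_)

  open Exterior K
  private
    module K = CommutativeRing K

  -- An inductive copy of _≈Λ_, whose proofs determine the elements they relate.
  infix 4 _≋_
  data _≋_ : ∀ {k} → Λ k → Λ k → Set (c ⊔ ℓ) where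
    ⟨_⟩≋ : ∀ {x y} → x K.≈ y → ⟨ x ⟩ ≋ ⟨ y ⟩
    _,≋_ : ∀ {k} {x₀ x₁ y₀ y₁ : Λ k} → x₀ ≋ y₀ → x₁ ≋ y₁ → (x₀ , x₁) ≋ (y₀ , y₁)

  ≋⇒≈Λ : ∀ {k} {x y : Λ k} → x ≋ y → x ≈Λ y
  ≋⇒≈Λ ⟨ p ⟩≋    = p
  ≋⇒≈Λ (p ,≋ q) = ≋⇒≈Λ p , ≋⇒≈Λ q

  ≈Λ⇒≋ : ∀ {k} {x y : Λ k} → x ≈Λ y → x ≋ y
  ≈Λ⇒≋ {x = ⟨ _ ⟩}  {⟨ _ ⟩}  p       = ⟨ p ⟩≋
  ≈Λ⇒≋ {x = _ , _} {_ , _} (p , q) = ≈Λ⇒≋ p ,≋ ≈Λ⇒≋ q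

  -- The product on Λ (suc k) involves ι on Λ k, so the ring laws and those of ι are proved together.
  record Laws (k : ℕ) : Set (c ⊔ ℓ) where
    field
      isRing : IsRing (_≋_ {k}) _+Λ_ _*Λ_ -Λ_ 0Λ 1Λ
      ι-cong : ∀ {x y : Λ k} → x ≋ y → ι x ≋ ι y
      ι-+    : ∀ (x y : Λ k) → ι (x +Λ y) ≋ ι x +Λ ι y
      ι-neg  : ∀ (x : Λ k) → ι (-Λ x) ≋ -Λ ι x
      ι-*    : ∀ (x y : Λ k) → ι (x *Λ y) ≋ ι x *Λ ι y
      ι-ι    : ∀ (x : Λ k) → ι (ι x) ≋ x
      ι-0    : ι (0Λ {k}) ≋ 0Λ
      ι-1    : ι (1Λ {k}) ≋ 1Λ

    ring : Ring c (c ⊔ ℓ)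
    ring = record { isRing = isRing }

  laws-zero : Laws zero
  laws-zero = record
    { isRing = RingMonomorphism.isRing unwrapIsMonomorphism K.isRing
    ; ι-cong = λ { ⟨ p ⟩≋ → ⟨ p ⟩≋ }
    ; ι-+    = λ { ⟨ _ ⟩ ⟨ _ ⟩ → ⟨ K.refl ⟩≋ }
    ; ι-neg  = λ { ⟨ _ ⟩ → ⟨ K.refl ⟩≋ }
    ; ι-*    = λ { ⟨ _ ⟩ ⟨ _ ⟩ → ⟨ K.refl ⟩≋ }
    ; ι-ι    = λ { ⟨ _ ⟩ → ⟨ K.refl ⟩≋ }
    ; ι-0    = ⟨ K.refl ⟩≋
    ; ι-1    = ⟨ K.refl ⟩≋
    }
    where
    Λ₀ : RawRing c (c ⊔ ℓ)
    Λ₀ = record { _≈_ = _≋_ {zero} ; _+_ = _+Λ_ ; _*_ = _*Λ_ ; -_ = -Λ_ ; 0# = 0Λ ; 1# = 1Λ }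

    unwrap : Λ zero → K.Carrier
    unwrap ⟨ r ⟩ = r

    unwrapIsMonomorphism : IsRingMonomorphism Λ₀ K.rawRing unwrap
    unwrapIsMonomorphism = record
      { isRingHomomorphism = record
        { isSemiringHomomorphism = record
          { isNearSemiringHomomorphism = record
            { +-isMonoidHomomorphism = record
              { isMagmaHomomorphism = record
                { isRelHomomorphism = record { cong = λ { ⟨ p ⟩≋ → p } }
                ; homo = λ { ⟨ _ ⟩ ⟨ _ ⟩ → K.refl } }
              ; ε-homo = K.refl }
            ; *-homo = λ { ⟨ _ ⟩ ⟨ _ ⟩ → K.refl } }
          ; 1#-homo = K.refl }
        ; -‿homo = λ { ⟨ _ ⟩ → K.refl } }
      ; injective = λ { {⟨ _ ⟩} {⟨ _ ⟩} p → ⟨ p ⟩≋ }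
      }

  module _ {k : ℕ} (L : Laws k) where
    open Laws L
    open Ring ring using (setoid; +-cong; +-congˡ; +-congʳ; *-cong; *-congˡ; *-congʳ; +-assoc; +-comm; *-assoc;
      distribˡ; distribʳ; +-identityˡ; +-identityʳ; *-identityˡ; *-identityʳ; -‿cong; -‿inverseˡ; -‿inverseʳ;
      zeroˡ; zeroʳ; +-commutativeSemigroup; +-abelianGroup) renaming (refl to ≋-refl; sym to ≋-sym; trans to ≋-trans)
    open RingProperties ring using (-‿distribˡ-*; -‿distribʳ-*; -‿involutive; -0#≈0#)
    open CommutativeSemigroupProperties +-commutativeSemigroup using (interchange)
    open AbelianGroupProperties +-abelianGroup using (⁻¹-∙-comm)
    open SetoidReasoning setoid

    private
      *-assoc′ : ∀ (x y z : Λ (suc k)) → (x *Λ y) *Λ z ≋ x *Λ (y *Λ z)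
      *-assoc′ (x₀ , x₁) (y₀ , y₁) (z₀ , z₁) = *-assoc x₀ y₀ z₀ ,≋ (begin
        ι (x₀ *Λ y₀) *Λ z₁ +Λ (ι x₀ *Λ y₁ +Λ x₁ *Λ y₀) *Λ z₀
          ≈⟨ +-cong (*-congʳ (ι-* x₀ y₀)) (distribʳ z₀ _ _) ⟩
        (ι x₀ *Λ ι y₀) *Λ z₁ +Λ ((ι x₀ *Λ y₁) *Λ z₀ +Λ (x₁ *Λ y₀) *Λ z₀)
          ≈⟨ +-assoc _ _ _ ⟨
        ((ι x₀ *Λ ι y₀) *Λ z₁ +Λ (ι x₀ *Λ y₁) *Λ z₀) +Λ (x₁ *Λ y₀) *Λ z₀
          ≈⟨ +-cong (+-cong (*-assoc _ _ _) (*-assoc _ _ _)) (*-assoc _ _ _) ⟩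
        (ι x₀ *Λ (ι y₀ *Λ z₁) +Λ ι x₀ *Λ (y₁ *Λ z₀)) +Λ x₁ *Λ (y₀ *Λ z₀)
          ≈⟨ +-congʳ (distribˡ _ _ _) ⟨
        ι x₀ *Λ (ι y₀ *Λ z₁ +Λ y₁ *Λ z₀) +Λ x₁ *Λ (y₀ *Λ z₀) ∎)

      *-identityˡ′ : ∀ (x : Λ (suc k)) → 1Λ *Λ x ≋ x
      *-identityˡ′ (x₀ , x₁) = *-identityˡ x₀ ,≋ (begin
        ι 1Λ *Λ x₁ +Λ 0Λ *Λ x₀ ≈⟨ +-cong (*-congʳ ι-1) (zeroˡ x₀) ⟩
        1Λ *Λ x₁ +Λ 0Λ         ≈⟨ +-identityʳ _ ⟩
        1Λ *Λ x₁               ≈⟨ *-identityˡ x₁ ⟩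
        x₁                     ∎)

      *-identityʳ′ : ∀ (x : Λ (suc k)) → x *Λ 1Λ ≋ x
      *-identityʳ′ (x₀ , x₁) = *-identityʳ x₀ ,≋ (begin
        ι x₀ *Λ 0Λ +Λ x₁ *Λ 1Λ ≈⟨ +-cong (zeroʳ _) (*-identityʳ x₁) ⟩
        0Λ +Λ x₁               ≈⟨ +-identityˡ _ ⟩
        x₁                     ∎)

      distribˡ′ : ∀ (x y z : Λ (suc k)) → x *Λ (y +Λ z) ≋ x *Λ y +Λ x *Λ z
      distribˡ′ (x₀ , x₁) (y₀ , y₁) (z₀ , z₁) = distribˡ x₀ y₀ z₀ ,≋ (begin
        ι x₀ *Λ (y₁ +Λ z₁) +Λ x₁ *Λ (y₀ +Λ z₀)
          ≈⟨ +-cong (distribˡ _ _ _) (distribˡ _ _ _) ⟩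
        (ι x₀ *Λ y₁ +Λ ι x₀ *Λ z₁) +Λ (x₁ *Λ y₀ +Λ x₁ *Λ z₀)
          ≈⟨ interchange _ _ _ _ ⟩
        (ι x₀ *Λ y₁ +Λ x₁ *Λ y₀) +Λ (ι x₀ *Λ z₁ +Λ x₁ *Λ z₀) ∎)

      distribʳ′ : ∀ (x y z : Λ (suc k)) → (y +Λ z) *Λ x ≋ y *Λ x +Λ z *Λ x
      distribʳ′ (x₀ , x₁) (y₀ , y₁) (z₀ , z₁) = distribʳ x₀ y₀ z₀ ,≋ (begin
        ι (y₀ +Λ z₀) *Λ x₁ +Λ (y₁ +Λ z₁) *Λ x₀
          ≈⟨ +-cong (≋-trans (*-congʳ (ι-+ y₀ z₀)) (distribʳ _ _ _)) (distribʳ _ _ _) ⟩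
        (ι y₀ *Λ x₁ +Λ ι z₀ *Λ x₁) +Λ (y₁ *Λ x₀ +Λ z₁ *Λ x₀)
          ≈⟨ interchange _ _ _ _ ⟩
        (ι y₀ *Λ x₁ +Λ y₁ *Λ x₀) +Λ (ι z₀ *Λ x₁ +Λ z₁ *Λ x₀) ∎)

      ι-*′ : ∀ (x y : Λ (suc k)) → ι (x *Λ y) ≋ ι x *Λ ι y
      ι-*′ (x₀ , x₁) (y₀ , y₁) = ι-* x₀ y₀ ,≋ (begin
        -Λ ι (ι x₀ *Λ y₁ +Λ x₁ *Λ y₀)
          ≈⟨ -‿cong (≋-trans (ι-+ _ _) (+-cong (≋-trans (ι-* _ _) (*-congʳ (ι-ι x₀))) (ι-* _ _))) ⟩
        -Λ (x₀ *Λ ι y₁ +Λ ι x₁ *Λ ι y₀)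
          ≈⟨ ⁻¹-∙-comm _ _ ⟨
        -Λ (x₀ *Λ ι y₁) +Λ -Λ (ι x₁ *Λ ι y₀)
          ≈⟨ +-cong (-‿distribʳ-* _ _) (-‿distribˡ-* _ _) ⟩
        x₀ *Λ (-Λ ι y₁) +Λ (-Λ ι x₁) *Λ ι y₀
          ≈⟨ +-congʳ (*-congʳ (ι-ι x₀)) ⟨
        ι (ι x₀) *Λ (-Λ ι y₁) +Λ (-Λ ι x₁) *Λ ι y₀ ∎)

      -ι0≋0 : -Λ ι (0Λ {k}) ≋ 0Λ
      -ι0≋0 = ≋-trans (-‿cong ι-0) -0#≈0#

    laws-suc : Laws (suc k)
    laws-suc = record
      { isRing = record
        { +-isAbelianGroup = record
          { isGroup = record
            { isMonoid = record
              { isSemigroup = record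
                { isMagma = record
                  { isEquivalence = record
                    { refl  = λ { {_ , _} → ≋-refl ,≋ ≋-refl }
                    ; sym   = λ { (p ,≋ q) → ≋-sym p ,≋ ≋-sym q }
                    ; trans = λ { (p ,≋ q) (p′ ,≋ q′) → ≋-trans p p′ ,≋ ≋-trans q q′ } }
                  ; ∙-cong = λ { (p ,≋ q) (p′ ,≋ q′) → +-cong p p′ ,≋ +-cong q q′ } }
                ; assoc = λ { (x₀ , x₁) (y₀ , y₁) (z₀ , z₁) → +-assoc x₀ y₀ z₀ ,≋ +-assoc x₁ y₁ z₁ } }
              ; identity = (λ { (x₀ , x₁) → +-identityˡ x₀ ,≋ +-identityˡ x₁ })
                         , (λ { (x₀ , x₁) → +-identityʳ x₀ ,≋ +-identityʳ x₁ }) }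
            ; inverse = (λ { (x₀ , x₁) → -‿inverseˡ x₀ ,≋ -‿inverseˡ x₁ })
                      , (λ { (x₀ , x₁) → -‿inverseʳ x₀ ,≋ -‿inverseʳ x₁ })
            ; ⁻¹-cong = λ { (p ,≋ q) → -‿cong p ,≋ -‿cong q } }
          ; comm = λ { (x₀ , x₁) (y₀ , y₁) → +-comm x₀ y₀ ,≋ +-comm x₁ y₁ } }
        ; *-cong = λ { (p ,≋ q) (p′ ,≋ q′) → *-cong p p′ ,≋ +-cong (*-cong (ι-cong p) q′) (*-cong q p′) }
        ; *-assoc = *-assoc′
        ; *-identity = *-identityˡ′ , *-identityʳ′
        ; distrib = distribˡ′ , distribʳ′ }
      ; ι-cong = λ { (p ,≋ q) → ι-cong p ,≋ -‿cong (ι-cong q) }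
      ; ι-+    = λ { (x₀ , x₁) (y₀ , y₁) → ι-+ x₀ y₀ ,≋ ≋-trans (-‿cong (ι-+ x₁ y₁)) (≋-sym (⁻¹-∙-comm (ι x₁) (ι y₁))) }
      ; ι-neg  = λ { (x₀ , x₁) → ι-neg x₀ ,≋ -‿cong (ι-neg x₁) }
      ; ι-*    = ι-*′
      ; ι-ι    = λ { (x₀ , x₁) → ι-ι x₀ ,≋ ≋-trans (-‿cong (ι-neg (ι x₁))) (≋-trans (-‿involutive _) (ι-ι x₁)) }
      ; ι-0    = ι-0 ,≋ -ι0≋0
      ; ι-1    = ι-1 ,≋ -ι0≋0
      }

  laws : ∀ k → Laws k
  laws zero    = laws-zero
  laws (suc k) = laws-suc (laws k)

  module _ {k : ℕ} where
    open Laws (laws k) public using (ι-cong; ι-+; ι-neg; ι-*; ι-ι; ι-0; ι-1; ring)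
    open Ring ring public using (setoid; refl; reflexive; sym; trans; +-cong; +-congˡ; +-congʳ; *-cong; *-congˡ; *-congʳ;
      +-assoc; +-comm; *-assoc; distribˡ; distribʳ; +-identityˡ; +-identityʳ; *-identityˡ; *-identityʳ;
      -‿cong; -‿inverseˡ; -‿inverseʳ; zeroˡ; zeroʳ; +-abelianGroup)
    open RingProperties ring public using (-‿distribˡ-*; -‿distribʳ-*; -‿involutive; -0#≈0#; x[y-z]≈xy-xz)
    open CommutativeSemigroupProperties (Ring.+-commutativeSemigroup ring) public using (interchange)
    open AbelianGroupProperties +-abelianGroup public using (⁻¹-∙-comm)
    open AbelianGroupSolver.Solve +-abelianGroup public using (solve)

  open AbelianGroupSolver public using (v₀; v₁; v₂; v₃; v₄; _⊕_; _⊖_; ⊝_)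

  module ≋-Reasoning {k : ℕ} = SetoidReasoning (setoid {k})

  -x*-y≋x*y : ∀ {k} (x y : Λ k) → (-Λ x) *Λ (-Λ y) ≋ x *Λ y
  -x*-y≋x*y x y = trans (sym (-‿distribˡ-* x (-Λ y))) (trans (-‿cong (sym (-‿distribʳ-* x y))) (-‿involutive _))

module GradedDerivation {c ℓ} (K : CommutativeRing c ℓ) where
  open import Level using (_⊔_)
  open import Data.Nat using (zero; suc)
  open import Data.Fin using (zero; suc)
  open import Data.Product using (Σ; _×_; _,_)
  open import Data.Vec using ([]; _∷_)

  open Exterior K
  open ExteriorRing K
  open ≋-Reasoning
  private
    module K = CommutativeRing K
  open K using (0#; 1#) renaming (Carrier to R; _+_ to _+K_; _*_ to _*K_; -_ to -K_)

  sc-cong : ∀ {k} {r s : R} → r K.≈ s → sc {k} r ≋ sc s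
  sc-cong {zero}  p = ⟨ p ⟩≋
  sc-cong {suc k} p = sc-cong p ,≋ refl

  sc-0 : ∀ {k} → sc {k} 0# ≋ 0Λ
  sc-0 {zero}  = refl
  sc-0 {suc k} = sc-0 ,≋ refl

  sc-1 : ∀ {k} → sc {k} 1# ≋ 1Λ
  sc-1 {zero}  = refl
  sc-1 {suc k} = sc-1 ,≋ refl

  sc-+ : ∀ {k} (r s : R) → sc {k} (r +K s) ≋ sc r +Λ sc s
  sc-+ {zero}  r s = refl
  sc-+ {suc k} r s = sc-+ r s ,≋ sym (+-identityˡ 0Λ)

  sc-neg : ∀ {k} (r : R) → sc {k} (-K r) ≋ -Λ sc r
  sc-neg {zero}  r = refl
  sc-neg {suc k} r = sc-neg r ,≋ sym -0#≈0#

  sc-* : ∀ {k} (r s : R) → sc {k} (r *K s) ≋ sc r *Λ sc s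
  sc-* {zero}  r s = refl
  sc-* {suc k} r s = sc-* r s ,≋ sym (trans (+-cong (zeroʳ _) (zeroˡ _)) (+-identityˡ 0Λ))

  ι-sc : ∀ {k} (r : R) → ι (sc {k} r) ≋ sc r
  ι-sc {zero}  r = refl
  ι-sc {suc k} r = ι-sc r ,≋ trans (-‿cong ι-0) -0#≈0#

  sc-central : ∀ {k} (r : R) (z : Λ k) → sc r *Λ z ≋ z *Λ sc r
  sc-central {zero}  r ⟨ z ⟩     = ⟨ K.*-comm r z ⟩≋
  sc-central {suc k} r (z₀ , z₁) = sc-central r z₀ ,≋ (begin
    ι (sc r) *Λ z₁ +Λ 0Λ *Λ z₀ ≈⟨ +-cong (*-congʳ (ι-sc r)) (zeroˡ z₀) ⟩
    sc r *Λ z₁ +Λ 0Λ           ≈⟨ +-identityʳ _ ⟩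
    sc r *Λ z₁                 ≈⟨ sc-central r z₁ ⟩
    z₁ *Λ sc r                 ≈⟨ +-identityˡ _ ⟨
    0Λ +Λ z₁ *Λ sc r           ≈⟨ +-congʳ (zeroʳ _) ⟨
    ι z₀ *Λ 0Λ +Λ z₁ *Λ sc r   ∎)

  -- K-linear combinations of the generators.
  DegreeOne : ∀ {k} → Λ k → Set (c ⊔ ℓ)
  DegreeOne {zero}  x         = x ≋ 0Λ
  DegreeOne {suc k} (g₀ , g₁) = DegreeOne g₀ × Σ R (λ r → g₁ ≋ sc r)

  DegreeOne-resp : ∀ {k} {x y : Λ k} → x ≋ y → DegreeOne x → DegreeOne y
  DegreeOne-resp {zero}  p           d             = trans (sym p) d
  DegreeOne-resp {suc k} (p₀ ,≋ p₁) (d , (r , h)) = DegreeOne-resp p₀ d , (r , trans (sym p₁) h)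

  DegreeOne-0 : ∀ {k} → DegreeOne (0Λ {k})
  DegreeOne-0 {zero}  = refl
  DegreeOne-0 {suc k} = DegreeOne-0 , (0# , sym sc-0)

  DegreeOne-+ : ∀ {k} {x y : Λ k} → DegreeOne x → DegreeOne y → DegreeOne (x +Λ y)
  DegreeOne-+ {zero}  {⟨ _ ⟩} {⟨ _ ⟩} ⟨ p ⟩≋        ⟨ q ⟩≋          = ⟨ K.trans (K.+-cong p q) (K.+-identityˡ 0#) ⟩≋
  DegreeOne-+ {suc k} {_ , _} {_ , _} (d , (r , h)) (d′ , (r′ , h′)) = DegreeOne-+ d d′ , (r +K r′ , trans (+-cong h h′) (sym (sc-+ r r′)))

  DegreeOne-neg : ∀ {k} {x : Λ k} → DegreeOne x → DegreeOne (-Λ x)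
  DegreeOne-neg {zero}              p             = trans (-‿cong p) -0#≈0#
  DegreeOne-neg {suc k} {_ , _} (d , (r , h)) = DegreeOne-neg d , (-K r , trans (-‿cong h) (sym (sc-neg r)))

  DegreeOne-e : ∀ {k} (i : Fin k) → DegreeOne (e i)
  DegreeOne-e {suc k} zero    = DegreeOne-0 , (1# , sym sc-1)
  DegreeOne-e {suc k} (suc i) = DegreeOne-e i , (0# , sym sc-0)

  ι-DegreeOne : ∀ {k} {g : Λ k} → DegreeOne g → ι g ≋ -Λ g
  ι-DegreeOne {zero}  {⟨ _ ⟩} d             = trans d (trans (sym -0#≈0#) (-‿cong (sym d)))
  ι-DegreeOne {suc k} {_ , _} (d , (r , h)) = ι-DegreeOne d ,≋ -‿cong (trans (ι-cong h) (trans (ι-sc r) (sym h)))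

  gradedComm : ∀ {k} {g : Λ k} → DegreeOne g → ∀ z → z *Λ g ≋ g *Λ ι z
  gradedComm {zero}  {⟨ _ ⟩} d ⟨ _ ⟩ = trans (*-congˡ d) (trans (zeroʳ _) (sym (trans (*-congʳ d) (zeroˡ _))))
  gradedComm {suc k} {g₀ , g₁} (d , (r , h)) (z₀ , z₁) = gradedComm d z₀ ,≋ (begin
    ι z₀ *Λ g₁ +Λ z₁ *Λ g₀           ≈⟨ +-cong (trans (*-congˡ h) (trans (sym (sc-central r _)) (*-congʳ (sym h)))) (gradedComm d z₁) ⟩
    g₁ *Λ ι z₀ +Λ g₀ *Λ ι z₁         ≈⟨ +-comm _ _ ⟩
    g₀ *Λ ι z₁ +Λ g₁ *Λ ι z₀         ≈⟨ +-congʳ (-x*-y≋x*y _ _) ⟨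
    (-Λ g₀) *Λ (-Λ ι z₁) +Λ g₁ *Λ ι z₀ ≈⟨ +-congʳ (*-congʳ (ι-DegreeOne d)) ⟨
    ι g₀ *Λ (-Λ ι z₁) +Λ g₁ *Λ ι z₀  ∎)

  square-zero : ∀ {k} {g : Λ k} → DegreeOne g → g *Λ g ≋ 0Λ
  square-zero {zero}  {⟨ _ ⟩}     d             = trans (*-congʳ d) (zeroˡ _)
  square-zero {suc k} {g₀ , g₁} (d , (r , h)) = square-zero d ,≋ (begin
    ι g₀ *Λ g₁ +Λ g₁ *Λ g₀          ≈⟨ +-cong (*-cong (ι-DegreeOne d) h) (*-congʳ h) ⟩
    (-Λ g₀) *Λ sc r +Λ sc r *Λ g₀   ≈⟨ +-cong (sym (-‿distribˡ-* _ _)) (sc-central r g₀) ⟩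
    -Λ (g₀ *Λ sc r) +Λ g₀ *Λ sc r   ≈⟨ -‿inverseˡ _ ⟩
    0Λ                              ∎)

  -- The graded derivation with ∂Λ e_i = 1: on x₀ + e₀ x₁ it is ∂Λ x₀ + x₁ − e₀ ∂Λ x₁.
  ∂Λ : ∀ {k} → Λ k → Λ k
  ∂Λ ⟨ _ ⟩     = 0Λ
  ∂Λ (x₀ , x₁) = (∂Λ x₀ +Λ x₁) , (-Λ ∂Λ x₁)

  ∂Λ-cong : ∀ {k} {x y : Λ k} → x ≋ y → ∂Λ x ≋ ∂Λ y
  ∂Λ-cong ⟨ _ ⟩≋   = refl
  ∂Λ-cong (p ,≋ q) = +-cong (∂Λ-cong p) q ,≋ -‿cong (∂Λ-cong q)

  ∂Λ-+ : ∀ {k} (x y : Λ k) → ∂Λ (x +Λ y) ≋ ∂Λ x +Λ ∂Λ y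
  ∂Λ-+ ⟨ _ ⟩     ⟨ _ ⟩     = sym (+-identityˡ 0Λ)
  ∂Λ-+ (x₀ , x₁) (y₀ , y₁) =
    trans (+-congʳ (∂Λ-+ x₀ y₀)) (interchange _ _ _ _) ,≋ trans (-‿cong (∂Λ-+ x₁ y₁)) (sym (⁻¹-∙-comm _ _))

  ∂Λ-neg : ∀ {k} (x : Λ k) → ∂Λ (-Λ x) ≋ -Λ ∂Λ x
  ∂Λ-neg ⟨ _ ⟩     = sym -0#≈0#
  ∂Λ-neg (x₀ , x₁) = trans (+-congʳ (∂Λ-neg x₀)) (⁻¹-∙-comm _ _) ,≋ -‿cong (∂Λ-neg x₁)

  ∂Λ-sc : ∀ {k} (r : R) → ∂Λ (sc {k} r) ≋ 0Λ
  ∂Λ-sc {zero}  r = refl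
  ∂Λ-sc {suc k} r = trans (+-identityʳ _) (∂Λ-sc r) ,≋ trans (-‿cong (trans (∂Λ-cong (sym sc-0)) (∂Λ-sc 0#))) -0#≈0#

  ∂Λ-0 : ∀ {k} → ∂Λ (0Λ {k}) ≋ 0Λ
  ∂Λ-0 = trans (∂Λ-cong (sym sc-0)) (∂Λ-sc 0#)

  ∂Λ-1 : ∀ {k} → ∂Λ (1Λ {k}) ≋ 0Λ
  ∂Λ-1 = trans (∂Λ-cong (sym sc-1)) (∂Λ-sc 1#)

  ∂Λ-e : ∀ {k} (i : Fin k) → ∂Λ (e i) ≋ 1Λ
  ∂Λ-e {suc k} zero    = trans (+-congʳ ∂Λ-0) (+-identityˡ _) ,≋ trans (-‿cong ∂Λ-1) -0#≈0#
  ∂Λ-e {suc k} (suc i) = trans (+-identityʳ _) (∂Λ-e i) ,≋ trans (-‿cong ∂Λ-0) -0#≈0#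

  ι-∂Λ : ∀ {k} (x : Λ k) → ι (∂Λ x) ≋ -Λ ∂Λ (ι x)
  ι-∂Λ ⟨ _ ⟩     = sym -0#≈0#
  ι-∂Λ (x₀ , x₁) = (begin
    ι (∂Λ x₀ +Λ x₁)               ≈⟨ ι-+ _ _ ⟩
    ι (∂Λ x₀) +Λ ι x₁             ≈⟨ +-cong (ι-∂Λ x₀) (sym (-‿involutive _)) ⟩
    -Λ ∂Λ (ι x₀) +Λ -Λ (-Λ ι x₁)  ≈⟨ ⁻¹-∙-comm _ _ ⟩
    -Λ (∂Λ (ι x₀) +Λ -Λ ι x₁)     ∎) ,≋ (begin
    -Λ ι (-Λ ∂Λ x₁)               ≈⟨ -‿cong (ι-neg _) ⟩
    -Λ (-Λ ι (∂Λ x₁))             ≈⟨ -‿cong (-‿cong (ι-∂Λ x₁)) ⟩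
    -Λ (-Λ (-Λ ∂Λ (ι x₁)))        ≈⟨ -‿cong (-‿cong (∂Λ-neg (ι x₁))) ⟨
    -Λ (-Λ ∂Λ (-Λ ι x₁))          ∎)

  ∂Λ-∂Λ : ∀ {k} (x : Λ k) → ∂Λ (∂Λ x) ≋ 0Λ
  ∂Λ-∂Λ ⟨ _ ⟩     = ∂Λ-0
  ∂Λ-∂Λ (x₀ , x₁) = (begin
    ∂Λ (∂Λ x₀ +Λ x₁) +Λ -Λ ∂Λ x₁       ≈⟨ +-congʳ (∂Λ-+ (∂Λ x₀) x₁) ⟩
    (∂Λ (∂Λ x₀) +Λ ∂Λ x₁) +Λ -Λ ∂Λ x₁  ≈⟨ +-congʳ (+-congʳ (∂Λ-∂Λ x₀)) ⟩
    (0Λ +Λ ∂Λ x₁) +Λ -Λ ∂Λ x₁          ≈⟨ trans (+-congʳ (+-identityˡ _)) (-‿inverseʳ _) ⟩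
    0Λ                                 ∎) ,≋ (begin
    -Λ ∂Λ (-Λ ∂Λ x₁)                   ≈⟨ -‿cong (∂Λ-neg (∂Λ x₁)) ⟩
    -Λ (-Λ ∂Λ (∂Λ x₁))                 ≈⟨ -‿involutive _ ⟩
    ∂Λ (∂Λ x₁)                         ≈⟨ ∂Λ-∂Λ x₁ ⟩
    0Λ                                 ∎)

  ∂Λ-* : ∀ {k} (x y : Λ k) → ∂Λ (x *Λ y) ≋ ∂Λ x *Λ y +Λ ι x *Λ ∂Λ y
  ∂Λ-* ⟨ _ ⟩     ⟨ _ ⟩     = sym (trans (+-cong (zeroˡ _) (zeroʳ _)) (+-identityˡ 0Λ))
  ∂Λ-* (x₀ , x₁) (y₀ , y₁) = (begin
    ∂Λ (x₀ *Λ y₀) +Λ (ι x₀ *Λ y₁ +Λ x₁ *Λ y₀)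
      ≈⟨ +-congʳ (∂Λ-* x₀ y₀) ⟩
    (∂Λ x₀ *Λ y₀ +Λ ι x₀ *Λ ∂Λ y₀) +Λ (ι x₀ *Λ y₁ +Λ x₁ *Λ y₀)
      ≈⟨ solve ((v₀ ⊕ v₁) ⊕ (v₂ ⊕ v₃)) ((v₀ ⊕ v₃) ⊕ (v₁ ⊕ v₂))
               (∂Λ x₀ *Λ y₀ ∷ ι x₀ *Λ ∂Λ y₀ ∷ ι x₀ *Λ y₁ ∷ x₁ *Λ y₀ ∷ []) ⟩
    (∂Λ x₀ *Λ y₀ +Λ x₁ *Λ y₀) +Λ (ι x₀ *Λ ∂Λ y₀ +Λ ι x₀ *Λ y₁)
      ≈⟨ +-cong (distribʳ _ _ _) (distribˡ _ _ _) ⟨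
    (∂Λ x₀ +Λ x₁) *Λ y₀ +Λ ι x₀ *Λ (∂Λ y₀ +Λ y₁) ∎) ,≋ (begin
    -Λ ∂Λ (ι x₀ *Λ y₁ +Λ x₁ *Λ y₀)
      ≈⟨ -‿cong (trans (∂Λ-+ (ι x₀ *Λ y₁) (x₁ *Λ y₀)) (+-cong (trans (∂Λ-* (ι x₀) y₁) (+-congˡ (*-congʳ (ι-ι x₀)))) (∂Λ-* x₁ y₀))) ⟩
    -Λ ((A +Λ B) +Λ (C +Λ E))
      ≈⟨ solve (⊝ ((v₀ ⊕ v₁) ⊕ (v₂ ⊕ v₃))) (((⊝ v₀ ⊕ v₄) ⊖ v₂) ⊕ (⊝ v₁ ⊖ (v₃ ⊕ v₄))) (A ∷ B ∷ C ∷ E ∷ F ∷ []) ⟩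
    ((-Λ A +Λ F) +Λ -Λ C) +Λ (-Λ B +Λ -Λ (E +Λ F))
      ≈⟨ +-cong (+-cong first (-‿distribˡ-* _ _)) (+-cong second third) ⟩
    (ι (∂Λ x₀ +Λ x₁) *Λ y₁ +Λ (-Λ ∂Λ x₁) *Λ y₀) +Λ (ι (ι x₀) *Λ (-Λ ∂Λ y₁) +Λ (-Λ ι x₁) *Λ (∂Λ y₀ +Λ y₁)) ∎)
    where
    A = ∂Λ (ι x₀) *Λ y₁
    B = x₀ *Λ ∂Λ y₁
    C = ∂Λ x₁ *Λ y₀
    E = ι x₁ *Λ ∂Λ y₀
    F = ι x₁ *Λ y₁
    first : -Λ A +Λ F ≋ ι (∂Λ x₀ +Λ x₁) *Λ y₁
    first = begin
      -Λ A +Λ F                          ≈⟨ +-congʳ (-‿distribˡ-* _ _) ⟩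
      (-Λ ∂Λ (ι x₀)) *Λ y₁ +Λ F          ≈⟨ distribʳ _ _ _ ⟨
      (-Λ ∂Λ (ι x₀) +Λ ι x₁) *Λ y₁       ≈⟨ *-congʳ (+-congʳ (ι-∂Λ x₀)) ⟨
      (ι (∂Λ x₀) +Λ ι x₁) *Λ y₁          ≈⟨ *-congʳ (ι-+ _ _) ⟨
      ι (∂Λ x₀ +Λ x₁) *Λ y₁              ∎
    second : -Λ B ≋ ι (ι x₀) *Λ (-Λ ∂Λ y₁)
    second = trans (-‿distribʳ-* _ _) (*-congʳ (sym (ι-ι x₀)))
    third : -Λ (E +Λ F) ≋ (-Λ ι x₁) *Λ (∂Λ y₀ +Λ y₁)
    third = trans (-‿cong (sym (distribˡ _ _ _))) (-‿distribˡ-* _ _)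

module Substitution {c ℓ} (K : CommutativeRing c ℓ) where
  open import Level using (_⊔_)
  open import Data.Nat using (zero; suc)
  open import Data.Fin using (zero; suc)
  open import Data.Product using (_×_; _,_; proj₁; proj₂)

  open Exterior K
  open ExteriorRing K
  open GradedDerivation K
  open ≋-Reasoning
  private
    module K = CommutativeRing K

  -- Affine combinations of the generators (coefficients summing to 1), and their differences.
  Affine : ∀ {k} → Λ k → Set (c ⊔ ℓ)
  Affine x = DegreeOne x × ∂Λ x ≋ 1Λ

  Affine-e : ∀ {k} (i : Fin k) → Affine (e i)
  Affine-e i = DegreeOne-e i , ∂Λ-e i

  Direction : ∀ {k} → Λ k → Set (c ⊔ ℓ)
  Direction x = DegreeOne x × ∂Λ x ≋ 0Λ

  Affine-resp : ∀ {k} {x y : Λ k} → x ≋ y → Affine x → Affine y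
  Affine-resp x≋y (d , ∂x) = DegreeOne-resp x≋y d , trans (∂Λ-cong (sym x≋y)) ∂x

  Affine-+ : ∀ {k} {x t : Λ k} → Affine x → Direction t → Affine (x +Λ t)
  Affine-+ {x = x} {t} (dx , ∂x) (dt , ∂t) =
    DegreeOne-+ dx dt , trans (∂Λ-+ x t) (trans (+-cong ∂x ∂t) (+-identityʳ 1Λ))

  Affine-− : ∀ {k} {x y : Λ k} → Affine x → Affine y → Direction (x -Λ y)
  Affine-− {x = x} {y} (dx , ∂x) (dy , ∂y) =
    DegreeOne-+ dx (DegreeOne-neg dy) , trans (∂Λ-+ x (-Λ y)) (trans (+-cong ∂x (trans (∂Λ-neg y) (-‿cong ∂y))) (-‿inverseʳ 1Λ))

  module _ {b : ℕ} where

    extend-cong : ∀ {a} (g : Fin a → Λ b) {x y : Λ a} → x ≋ y → extend g x ≋ extend g y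
    extend-cong g ⟨ p ⟩≋   = sc-cong p
    extend-cong g (p ,≋ q) = +-cong (extend-cong _ p) (*-congˡ (extend-cong _ q))

    extend-cong-gens : ∀ {a} {g h : Fin a → Λ b} → (∀ i → g i ≋ h i) → ∀ x → extend g x ≋ extend h x
    extend-cong-gens g≋h ⟨ _ ⟩     = refl
    extend-cong-gens g≋h (x₀ , x₁) =
      +-cong (extend-cong-gens (λ i → g≋h (suc i)) x₀) (*-cong (g≋h zero) (extend-cong-gens (λ i → g≋h (suc i)) x₁))

    extend-+ : ∀ {a} (g : Fin a → Λ b) (x y : Λ a) → extend g (x +Λ y) ≋ extend g x +Λ extend g y
    extend-+ g ⟨ r ⟩     ⟨ s ⟩     = sc-+ r s
    extend-+ g (x₀ , x₁) (y₀ , y₁) = begin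
      extend g′ (x₀ +Λ y₀) +Λ g zero *Λ extend g′ (x₁ +Λ y₁)
        ≈⟨ +-cong (extend-+ g′ x₀ y₀) (trans (*-congˡ (extend-+ g′ x₁ y₁)) (distribˡ _ _ _)) ⟩
      (extend g′ x₀ +Λ extend g′ y₀) +Λ (g zero *Λ extend g′ x₁ +Λ g zero *Λ extend g′ y₁)
        ≈⟨ interchange _ _ _ _ ⟩
      (extend g′ x₀ +Λ g zero *Λ extend g′ x₁) +Λ (extend g′ y₀ +Λ g zero *Λ extend g′ y₁) ∎
      where g′ = λ i → g (suc i)

    extend-neg : ∀ {a} (g : Fin a → Λ b) (x : Λ a) → extend g (-Λ x) ≋ -Λ extend g x
    extend-neg g ⟨ r ⟩     = sc-neg r
    extend-neg g (x₀ , x₁) = begin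
      extend g′ (-Λ x₀) +Λ g zero *Λ extend g′ (-Λ x₁)
        ≈⟨ +-cong (extend-neg g′ x₀) (trans (*-congˡ (extend-neg g′ x₁)) (sym (-‿distribʳ-* _ _))) ⟩
      -Λ extend g′ x₀ +Λ -Λ (g zero *Λ extend g′ x₁) ≈⟨ ⁻¹-∙-comm _ _ ⟩
      -Λ (extend g′ x₀ +Λ g zero *Λ extend g′ x₁)    ∎
      where g′ = λ i → g (suc i)

    extend-minus : ∀ {a} (g : Fin a → Λ b) x y → extend g (x -Λ y) ≋ extend g x -Λ extend g y
    extend-minus g x y = trans (extend-+ g x (-Λ y)) (+-congˡ (extend-neg g y))

    extend-sc : ∀ {a} (g : Fin a → Λ b) r → extend g (sc r) ≋ sc r
    extend-sc {zero}  g r = refl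
    extend-sc {suc a} g r = begin
      extend g′ (sc r) +Λ g zero *Λ extend g′ 0Λ ≈⟨ +-cong (extend-sc g′ r) (*-congˡ (extend-cong g′ (sym sc-0))) ⟩
      sc r +Λ g zero *Λ extend g′ (sc K.0#)     ≈⟨ +-congˡ (*-congˡ (trans (extend-sc g′ K.0#) sc-0)) ⟩
      sc r +Λ g zero *Λ 0Λ                      ≈⟨ trans (+-congˡ (zeroʳ _)) (+-identityʳ _) ⟩
      sc r                                      ∎
      where g′ = λ i → g (suc i)

    extend-0 : ∀ {a} (g : Fin a → Λ b) → extend g 0Λ ≋ 0Λ
    extend-0 g = trans (extend-cong g (sym sc-0)) (trans (extend-sc g K.0#) sc-0)

    extend-1 : ∀ {a} (g : Fin a → Λ b) → extend g 1Λ ≋ 1Λ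
    extend-1 g = trans (extend-cong g (sym sc-1)) (trans (extend-sc g K.1#) sc-1)

    extend-e : ∀ {a} (g : Fin a → Λ b) i → extend g (e i) ≋ g i
    extend-e {suc a} g zero    = begin
      extend g′ 0Λ +Λ g zero *Λ extend g′ 1Λ ≈⟨ +-cong (extend-0 g′) (*-congˡ (extend-1 g′)) ⟩
      0Λ +Λ g zero *Λ 1Λ                     ≈⟨ trans (+-identityˡ _) (*-identityʳ _) ⟩
      g zero                                 ∎
      where g′ = λ i → g (suc i)
    extend-e {suc a} g (suc i) = begin
      extend g′ (e i) +Λ g zero *Λ extend g′ 0Λ ≈⟨ +-cong (extend-e g′ i) (*-congˡ (extend-0 g′)) ⟩
      g (suc i) +Λ g zero *Λ 0Λ                 ≈⟨ trans (+-congˡ (zeroʳ _)) (+-identityʳ _) ⟩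
      g (suc i)                                 ∎
      where g′ = λ i → g (suc i)

    extend-ι : ∀ {a} (g : Fin a → Λ b) → (∀ i → DegreeOne (g i)) → ∀ x → extend g (ι x) ≋ ι (extend g x)
    extend-ι g deg ⟨ r ⟩     = sym (ι-sc r)
    extend-ι g deg (x₀ , x₁) = begin
      extend g′ (ι x₀) +Λ g zero *Λ extend g′ (-Λ ι x₁)
        ≈⟨ +-cong (extend-ι g′ deg′ x₀) (*-congˡ (trans (extend-neg g′ (ι x₁)) (-‿cong (extend-ι g′ deg′ x₁)))) ⟩
      ι (extend g′ x₀) +Λ g zero *Λ (-Λ ι (extend g′ x₁))
        ≈⟨ +-congˡ (trans (sym (-‿distribʳ-* _ _)) (-‿distribˡ-* _ _)) ⟩
      ι (extend g′ x₀) +Λ (-Λ g zero) *Λ ι (extend g′ x₁)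
        ≈⟨ +-congˡ (*-congʳ (ι-DegreeOne (deg zero))) ⟨
      ι (extend g′ x₀) +Λ ι (g zero) *Λ ι (extend g′ x₁)
        ≈⟨ trans (ι-+ _ _) (+-congˡ (ι-* _ _)) ⟨
      ι (extend g′ x₀ +Λ g zero *Λ extend g′ x₁) ∎
      where g′ = λ i → g (suc i)
            deg′ = λ i → deg (suc i)

    extend-* : ∀ {a} (g : Fin a → Λ b) → (∀ i → DegreeOne (g i)) → ∀ x y → extend g (x *Λ y) ≋ extend g x *Λ extend g y
    extend-* g deg ⟨ r ⟩     ⟨ s ⟩     = sc-* r s
    extend-* g deg (x₀ , x₁) (y₀ , y₁) = begin
      extend g′ (x₀ *Λ y₀) +Λ G *Λ extend g′ (ι x₀ *Λ y₁ +Λ x₁ *Λ y₀)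
        ≈⟨ +-cong (extend-* g′ deg′ x₀ y₀) (*-congˡ (trans (extend-+ g′ _ _)
             (+-cong (trans (extend-* g′ deg′ _ _) (*-congʳ (extend-ι g′ deg′ x₀))) (extend-* g′ deg′ _ _)))) ⟩
      X₀ *Λ Y₀ +Λ G *Λ (ι X₀ *Λ Y₁ +Λ X₁ *Λ Y₀)
        ≈⟨ +-congˡ (trans (distribˡ _ _ _) (+-cong G-past-X₀ (sym (*-assoc _ _ _)))) ⟩
      X₀ *Λ Y₀ +Λ (X₀ *Λ (G *Λ Y₁) +Λ (G *Λ X₁) *Λ Y₀)
        ≈⟨ +-assoc _ _ _ ⟨
      (X₀ *Λ Y₀ +Λ X₀ *Λ (G *Λ Y₁)) +Λ (G *Λ X₁) *Λ Y₀
        ≈⟨ +-congˡ (trans (+-congˡ GG≋0) (+-identityʳ _)) ⟨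
      (X₀ *Λ Y₀ +Λ X₀ *Λ (G *Λ Y₁)) +Λ ((G *Λ X₁) *Λ Y₀ +Λ (G *Λ X₁) *Λ (G *Λ Y₁))
        ≈⟨ +-cong (distribˡ _ _ _) (distribˡ _ _ _) ⟨
      X₀ *Λ (Y₀ +Λ G *Λ Y₁) +Λ (G *Λ X₁) *Λ (Y₀ +Λ G *Λ Y₁)
        ≈⟨ distribʳ _ _ _ ⟨
      (X₀ +Λ G *Λ X₁) *Λ (Y₀ +Λ G *Λ Y₁) ∎
      where
      g′ = λ i → g (suc i)
      deg′ = λ i → deg (suc i)
      G = g zero
      X₀ = extend g′ x₀
      X₁ = extend g′ x₁
      Y₀ = extend g′ y₀
      Y₁ = extend g′ y₁
      G-past-X₀ : G *Λ (ι X₀ *Λ Y₁) ≋ X₀ *Λ (G *Λ Y₁)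
      G-past-X₀ = begin
        G *Λ (ι X₀ *Λ Y₁) ≈⟨ *-assoc _ _ _ ⟨
        (G *Λ ι X₀) *Λ Y₁ ≈⟨ *-congʳ (gradedComm (deg zero) X₀) ⟨
        (X₀ *Λ G) *Λ Y₁   ≈⟨ *-assoc _ _ _ ⟩
        X₀ *Λ (G *Λ Y₁)   ∎
      GG≋0 : (G *Λ X₁) *Λ (G *Λ Y₁) ≋ 0Λ
      GG≋0 = begin
        (G *Λ X₁) *Λ (G *Λ Y₁)   ≈⟨ *-assoc _ _ _ ⟩
        G *Λ (X₁ *Λ (G *Λ Y₁))   ≈⟨ *-congˡ (*-assoc _ _ _) ⟨
        G *Λ ((X₁ *Λ G) *Λ Y₁)   ≈⟨ *-congˡ (*-congʳ (gradedComm (deg zero) X₁)) ⟩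
        G *Λ ((G *Λ ι X₁) *Λ Y₁) ≈⟨ trans (*-congˡ (*-assoc _ _ _)) (sym (*-assoc _ _ _)) ⟩
        (G *Λ G) *Λ (ι X₁ *Λ Y₁) ≈⟨ trans (*-congʳ (square-zero (deg zero))) (zeroˡ _) ⟩
        0Λ                       ∎

    extend-∂Λ : ∀ {a} (g : Fin a → Λ b) → (∀ i → Affine (g i)) → ∀ x → extend g (∂Λ x) ≋ ∂Λ (extend g x)
    extend-∂Λ g aff ⟨ r ⟩     = trans (extend-0 g) (sym (∂Λ-sc r))
    extend-∂Λ g aff (x₀ , x₁) = begin
      extend g′ (∂Λ x₀ +Λ x₁) +Λ G *Λ extend g′ (-Λ ∂Λ x₁)
        ≈⟨ +-cong (trans (extend-+ g′ _ _) (+-congʳ (extend-∂Λ g′ aff′ x₀)))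
                  (*-congˡ (trans (extend-neg g′ _) (-‿cong (extend-∂Λ g′ aff′ x₁)))) ⟩
      (∂Λ X₀ +Λ X₁) +Λ G *Λ (-Λ ∂Λ X₁)      ≈⟨ +-assoc _ _ _ ⟩
      ∂Λ X₀ +Λ (X₁ +Λ G *Λ (-Λ ∂Λ X₁))      ≈⟨ +-congˡ (+-cong (*-identityˡ _) G*-∂X₁) ⟨
      ∂Λ X₀ +Λ (1Λ *Λ X₁ +Λ ι G *Λ ∂Λ X₁)   ≈⟨ +-congˡ (+-congʳ (*-congʳ (proj₂ (aff zero)))) ⟨
      ∂Λ X₀ +Λ (∂Λ G *Λ X₁ +Λ ι G *Λ ∂Λ X₁) ≈⟨ +-congˡ (∂Λ-* G X₁) ⟨
      ∂Λ X₀ +Λ ∂Λ (G *Λ X₁)                 ≈⟨ ∂Λ-+ X₀ (G *Λ X₁) ⟨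
      ∂Λ (X₀ +Λ G *Λ X₁)                    ∎
      where
      g′ = λ i → g (suc i)
      aff′ = λ i → aff (suc i)
      G = g zero
      X₀ = extend g′ x₀
      X₁ = extend g′ x₁
      G*-∂X₁ : ι G *Λ ∂Λ X₁ ≋ G *Λ (-Λ ∂Λ X₁)
      G*-∂X₁ = trans (*-congʳ (ι-DegreeOne (proj₁ (aff zero)))) (trans (sym (-‿distribˡ-* _ _)) (-‿distribʳ-* _ _))

    extend-∘ : ∀ {a a′} (g : Fin a′ → Λ b) → (∀ i → DegreeOne (g i)) → (h : Fin a → Λ a′) → ∀ x →
               extend g (extend h x) ≋ extend (λ i → extend g (h i)) x
    extend-∘ g deg h ⟨ r ⟩     = extend-sc g r
    extend-∘ g deg h (x₀ , x₁) =
      trans (extend-+ g _ _) (+-cong (extend-∘ g deg _ x₀) (trans (extend-* g deg _ _) (*-congˡ (extend-∘ g deg _ x₁))))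

  private
    extend-lift : ∀ {a b} (g : Fin a → Λ b) (x : Λ a) → extend (λ i → (g i , 0Λ)) x ≋ (extend g x , 0Λ)
    extend-lift g ⟨ r ⟩     = refl ,≋ refl
    extend-lift g (x₀ , x₁) = begin
      extend g″ x₀ +Λ (g zero , 0Λ) *Λ extend g″ x₁
        ≈⟨ +-cong (extend-lift _ x₀) (*-congˡ (extend-lift _ x₁)) ⟩
      (extend g′ x₀ , 0Λ) +Λ (g zero , 0Λ) *Λ (extend g′ x₁ , 0Λ)
        ≈⟨ refl ,≋ trans (+-congˡ (trans (+-cong (zeroʳ _) (zeroˡ _)) (+-identityˡ 0Λ))) (+-identityˡ 0Λ) ⟩
      (extend g′ x₀ +Λ g zero *Λ extend g′ x₁ , 0Λ) ∎
      where
      g′ = λ i → g (suc i)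
      g″ = λ i → (g (suc i) , 0Λ)

  extend-e-identity : ∀ {a} (x : Λ a) → extend e x ≋ x
  extend-e-identity ⟨ _ ⟩     = refl
  extend-e-identity (x₀ , x₁) = begin
    extend (λ i → e (suc i)) x₀ +Λ e zero *Λ extend (λ i → e (suc i)) x₁
      ≈⟨ +-cong (extend-lift e x₀) (*-congˡ (extend-lift e x₁)) ⟩
    (extend e x₀ , 0Λ) +Λ (0Λ , 1Λ) *Λ (extend e x₁ , 0Λ)
      ≈⟨ trans (+-cong (extend-e-identity x₀) (zeroˡ _)) (+-identityʳ _)
         ,≋ trans (+-identityˡ _) (trans (+-cong (zeroʳ _) (*-identityˡ _)) (trans (+-identityˡ _) (extend-e-identity x₁))) ⟩
    (x₀ , x₁) ∎

module Products {c ℓ} (K : CommutativeRing c ℓ) where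
  open import Level using (_⊔_)
  open import Data.Fin using (zero; suc)
  open import Data.Fin.Subset using (Subset; _∈_; _-_)
  open import Data.Fin.Subset.Properties using (p─⊥≡p)
  open import Data.Vec using (here; there) renaming ([] to []ᵥ; _∷_ to _∷ᵥ_)
  open import Data.Bool using (true; false)
  open import Data.Product using (_,_; proj₁; proj₂)
  open import Data.Sum using (_⊎_; inj₁; inj₂)
  open import Data.List using (List; []; _∷_; map; foldr; _++_; _∷ʳ_; initLast; _∷ʳ′_)
  open import Data.List.Properties using (map-++; map-∘; map-id)
  open import Data.List.Relation.Unary.All as All using (All; []; _∷_; universal)
  open import Data.List.Relation.Unary.All.Properties using (++⁻; map⁺)
  open import Function using (_∘_; id)
  open import Relation.Binary.Bundles using (Setoid)
  open import Relation.Binary.Structures using (IsEquivalence)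
  import Relation.Binary.Reasoning.Setoid as SetoidReasoning
  open import Relation.Binary.PropositionalEquality as ≡ using (_≡_)

  open Exterior K
  open ExteriorRing K
  open GradedDerivation K
  open Substitution K

  ∏ : ∀ {k} → List (Λ k) → Λ k
  ∏ = foldr _*Λ_ 1Λ

  module _ {k : ℕ} where

    ∏-++ : (xs ys : List (Λ k)) → ∏ (xs ++ ys) ≋ ∏ xs *Λ ∏ ys
    ∏-++ []       ys = sym (*-identityˡ _)
    ∏-++ (x ∷ xs) ys = trans (*-congˡ (∏-++ xs ys)) (sym (*-assoc _ _ _))

    ∏-∷ʳ : (xs : List (Λ k)) (w : Λ k) → ∏ (xs ∷ʳ w) ≋ ∏ xs *Λ w
    ∏-∷ʳ xs w = trans (∏-++ xs (w ∷ [])) (*-congˡ (*-identityʳ w))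

    ∏-map-cong : ∀ {a} {A : Set a} {f g : A → Λ k} → (∀ x → f x ≋ g x) → ∀ l → ∏ (map f l) ≋ ∏ (map g l)
    ∏-map-cong f≋g []      = refl
    ∏-map-cong f≋g (x ∷ l) = *-cong (f≋g x) (∏-map-cong f≋g l)

    -- Signs are irrelevant for membership in an ideal.
    infix 4 _≈±_
    _≈±_ : Λ k → Λ k → Set (c ⊔ ℓ)
    x ≈± y = x ≋ y ⊎ x ≋ -Λ y

    ≋⇒≈± : ∀ {x y} → x ≋ y → x ≈± y
    ≋⇒≈± = inj₁

    ≈±-neg : ∀ {x y} → x ≋ -Λ y → x ≈± y
    ≈±-neg = inj₂

    ≈±-refl : ∀ {x} → x ≈± x
    ≈±-refl = inj₁ refl

    ≈±-isEquivalence : IsEquivalence _≈±_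
    ≈±-isEquivalence = record
      { refl  = ≈±-refl
      ; sym   = λ { (inj₁ p) → inj₁ (sym p) ; (inj₂ p) → inj₂ (trans (sym (-‿involutive _)) (-‿cong (sym p))) }
      ; trans = λ { (inj₁ p) (inj₁ q) → inj₁ (trans p q)
                  ; (inj₁ p) (inj₂ q) → inj₂ (trans p q)
                  ; (inj₂ p) (inj₁ q) → inj₂ (trans p (-‿cong q))
                  ; (inj₂ p) (inj₂ q) → inj₁ (trans p (trans (-‿cong q) (-‿involutive _))) }
      }

    ≈±-setoid : Setoid c (c ⊔ ℓ)
    ≈±-setoid = record { isEquivalence = ≈±-isEquivalence }

    ≈±-cong : (f : Λ k → Λ k) → (∀ {x y} → x ≋ y → f x ≋ f y) → (∀ x → f (-Λ x) ≋ -Λ f x) →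
              ∀ {x y} → x ≈± y → f x ≈± f y
    ≈±-cong f f-cong f-neg (inj₁ p) = inj₁ (f-cong p)
    ≈±-cong f f-cong f-neg (inj₂ p) = inj₂ (trans (f-cong p) (f-neg _))

  module ≈±-Reasoning {k : ℕ} = SetoidReasoning (≈±-setoid {k})

  ∂Λ-≈± : ∀ {k} {x y : Λ k} → x ≈± y → ∂Λ x ≈± ∂Λ y
  ∂Λ-≈± = ≈±-cong ∂Λ ∂Λ-cong ∂Λ-neg

  *ʳ-≈± : ∀ {k} {x y : Λ k} z → x ≈± y → x *Λ z ≈± y *Λ z
  *ʳ-≈± z = ≈±-cong (_*Λ z) *-congʳ (λ _ → sym (-‿distribˡ-* _ _))

  *ˡ-≈± : ∀ {k} {x y : Λ k} z → x ≈± y → z *Λ x ≈± z *Λ y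
  *ˡ-≈± z = ≈±-cong (z *Λ_) *-congˡ (λ _ → sym (-‿distribʳ-* _ _))

  *-past-DegreeOne : ∀ {k} {t : Λ k} → DegreeOne t → ∀ x → t *Λ x ≋ ι x *Λ t
  *-past-DegreeOne d x = sym (trans (gradedComm d (ι x)) (*-congˡ (ι-ι x)))

  ι-∏ : ∀ {k} {us : List (Λ k)} → All DegreeOne us → ι (∏ us) ≈± ∏ us
  ι-∏ []                 = ≋⇒≈± ι-1
  ι-∏ {us = u ∷ us} (d ∷ ds) = begin
    ι (u *Λ ∏ us)       ≈⟨ ≋⇒≈± (trans (ι-* _ _) (*-congʳ (ι-DegreeOne d))) ⟩
    (-Λ u) *Λ ι (∏ us)  ≈⟨ *ˡ-≈± _ (ι-∏ ds) ⟩
    (-Λ u) *Λ ∏ us      ≈⟨ ≈±-neg (sym (-‿distribˡ-* _ _)) ⟩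
    u *Λ ∏ us           ∎
    where open ≈±-Reasoning

  ∏-rotate : ∀ {k} {a : Λ k} {us} → DegreeOne a → All DegreeOne us → ∏ (a ∷ us) ≈± ∏ (us ∷ʳ a)
  ∏-rotate {a = a} {us} da dus = begin
    a *Λ ∏ us       ≈⟨ ≋⇒≈± (*-past-DegreeOne da (∏ us)) ⟩
    ι (∏ us) *Λ a   ≈⟨ *ʳ-≈± a (ι-∏ dus) ⟩
    ∏ us *Λ a       ≈⟨ ≋⇒≈± (∏-∷ʳ us a) ⟨
    ∏ (us ∷ʳ a)     ∎
    where open ≈±-Reasoning

  ∂Λ-∏-closed : ∀ {k} {vs : List (Λ k)} → All (λ v → ∂Λ v ≋ 0Λ) vs → ∂Λ (∏ vs) ≋ 0Λ
  ∂Λ-∏-closed []                      = ∂Λ-1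
  ∂Λ-∏-closed {vs = v ∷ vs} (∂v ∷ ∂vs) = begin
    ∂Λ (v *Λ ∏ vs)                        ≈⟨ ∂Λ-* v (∏ vs) ⟩
    ∂Λ v *Λ ∏ vs +Λ ι v *Λ ∂Λ (∏ vs)      ≈⟨ +-cong (*-congʳ ∂v) (*-congˡ (∂Λ-∏-closed ∂vs)) ⟩
    0Λ *Λ ∏ vs +Λ ι v *Λ 0Λ               ≈⟨ trans (+-cong (zeroˡ _) (zeroʳ _)) (+-identityʳ 0Λ) ⟩
    0Λ                                    ∎
    where open ≋-Reasoning

  -- t * t = 0, and t anticommutes with the remaining factors.
  ∏-translate-* : ∀ {k} {t : Λ k} → DegreeOne t → ∀ us → ∏ (map (_+Λ t) us) *Λ t ≋ ∏ us *Λ t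
  ∏-translate-*     dt []       = refl
  ∏-translate-* {t = t} dt (u ∷ us) = begin
    ((u +Λ t) *Λ Pt) *Λ t          ≈⟨ *-assoc _ _ _ ⟩
    (u +Λ t) *Λ (Pt *Λ t)          ≈⟨ *-congˡ (∏-translate-* dt us) ⟩
    (u +Λ t) *Λ (P *Λ t)           ≈⟨ distribʳ _ _ _ ⟩
    u *Λ (P *Λ t) +Λ t *Λ (P *Λ t) ≈⟨ +-congˡ t*P*t≋0 ⟩
    u *Λ (P *Λ t) +Λ 0Λ            ≈⟨ trans (+-identityʳ _) (sym (*-assoc _ _ _)) ⟩
    (u *Λ P) *Λ t                  ∎
    where
    open ≋-Reasoning
    Pt = ∏ (map (_+Λ t) us)
    P  = ∏ us
    t*P*t≋0 : t *Λ (P *Λ t) ≋ 0Λ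
    t*P*t≋0 = begin
      t *Λ (P *Λ t)    ≈⟨ *-assoc _ _ _ ⟨
      (t *Λ P) *Λ t    ≈⟨ *-congʳ (*-past-DegreeOne dt P) ⟩
      (ι P *Λ t) *Λ t  ≈⟨ *-assoc _ _ _ ⟩
      ι P *Λ (t *Λ t)  ≈⟨ trans (*-congˡ (square-zero dt)) (zeroʳ _) ⟩
      0Λ               ∎

  -- Write each u as (u − w) + w: the translation by w disappears against the last factor w,
  -- and ∂Λ kills every u − w.
  ∂Λ-∏-∷ʳ : ∀ {k} {us : List (Λ k)} {w} → All Affine us → Affine w → ∂Λ (∏ (us ∷ʳ w)) ≈± ∏ (map (_-Λ w) us)
  ∂Λ-∏-∷ʳ {us = us} {w} aff-us (dw , ∂w) = begin
    ∂Λ (∏ (us ∷ʳ w))                      ≈⟨ ≋⇒≈± (∂Λ-cong (trans (∏-∷ʳ us w) (*-congʳ us≋vs+w))) ⟩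
    ∂Λ (∏ (map (_+Λ w) vs) *Λ w)          ≈⟨ ≋⇒≈± (∂Λ-cong (∏-translate-* dw vs)) ⟩
    ∂Λ (∏ vs *Λ w)                        ≈⟨ ≋⇒≈± (∂Λ-* (∏ vs) w) ⟩
    ∂Λ (∏ vs) *Λ w +Λ ι (∏ vs) *Λ ∂Λ w    ≈⟨ ≋⇒≈± (+-cong (*-congʳ (∂Λ-∏-closed ∂vs≋0)) (*-congˡ ∂w)) ⟩
    0Λ *Λ w +Λ ι (∏ vs) *Λ 1Λ             ≈⟨ ≋⇒≈± (trans (+-cong (zeroˡ w) (*-identityʳ _)) (+-identityˡ _)) ⟩
    ι (∏ vs)                              ≈⟨ ι-∏ (map⁺ (All.map (λ a → proj₁ (Affine-− a (dw , ∂w))) aff-us)) ⟩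
    ∏ vs                                  ∎
    where
    open ≈±-Reasoning
    vs = map (_-Λ w) us
    us≋vs+w : ∏ us ≋ ∏ (map (_+Λ w) vs)
    us≋vs+w = trans (reflexive (≡.cong ∏ (≡.sym (map-id us))))
                (trans (∏-map-cong {f = id} {g = λ u → (u -Λ w) +Λ w} (λ u → solve v₀ ((v₀ ⊖ v₁) ⊕ v₁) (u ∷ᵥ w ∷ᵥ []ᵥ)) us)
                       (reflexive (≡.cong ∏ (map-∘ us))))
    ∂vs≋0 : All (λ v → ∂Λ v ≋ 0Λ) vs
    ∂vs≋0 = map⁺ (All.map (λ a → proj₂ (Affine-− a (dw , ∂w))) aff-us)

  ∂Λ-∏-translate : ∀ {k} {t : Λ k} {us} → Direction t → All Affine us → ∂Λ (∏ (map (_+Λ t) us)) ≈± ∂Λ (∏ us)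
  ∂Λ-∏-translate {t = t} {us} dir aff-us with initLast us
  ... | []       = ≈±-refl
  ... | vs ∷ʳ′ w with ++⁻ vs aff-us
  ...   | aff-vs , (aff-w ∷ []) = begin
    ∂Λ (∏ (map (_+Λ t) (vs ∷ʳ w)))                   ≡⟨ ≡.cong (∂Λ ∘ ∏) (map-++ (_+Λ t) vs (w ∷ [])) ⟩
    ∂Λ (∏ (map (_+Λ t) vs ∷ʳ (w +Λ t)))              ≈⟨ ∂Λ-∏-∷ʳ (map⁺ (All.map (λ a → Affine-+ a dir) aff-vs)) (Affine-+ aff-w dir) ⟩
    ∏ (map (_-Λ (w +Λ t)) (map (_+Λ t) vs))          ≈⟨ ≋⇒≈± (trans (reflexive (≡.cong ∏ (≡.sym (map-∘ vs)))) (∏-map-cong cancel-t vs)) ⟩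
    ∏ (map (_-Λ w) vs)                               ≈⟨ ∂Λ-∏-∷ʳ aff-vs aff-w ⟨
    ∂Λ (∏ (vs ∷ʳ w))                                 ∎
    where
    open ≈±-Reasoning
    cancel-t : ∀ v → (v +Λ t) -Λ (w +Λ t) ≋ v -Λ w
    cancel-t v = solve ((v₀ ⊕ v₂) ⊖ (v₁ ⊕ v₂)) (v₀ ⊖ v₁) (v ∷ᵥ w ∷ᵥ t ∷ᵥ []ᵥ)

  prodE≡∏ : ∀ {k} (l : List (Fin k)) → prodE l ≡ ∏ (map e l)
  prodE≡∏ []      = ≡.refl
  prodE≡∏ (i ∷ l) = ≡.cong (e i *Λ_) (prodE≡∏ l)

  private
    altSum-e* : ∀ {k} (i : Fin k) (L : List (List (Fin k))) →
                altSum (map prodE (map (i ∷_) L)) ≋ e i *Λ altSum (map prodE L)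
    altSum-e* i []      = sym (zeroʳ _)
    altSum-e* i (l ∷ L) = trans (+-congˡ (trans (-‿cong (altSum-e* i L)) (-‿distribʳ-* _ _))) (sym (distribˡ _ _ _))

  ∂≋∂Λ∘∏ : ∀ {k} (l : List (Fin k)) → ∂ l ≋ ∂Λ (∏ (map e l))
  ∂≋∂Λ∘∏ []      = sym ∂Λ-1
  ∂≋∂Λ∘∏ (i ∷ l) = begin
    prodE l +Λ -Λ altSum (map prodE (map (i ∷_) (deletions l)))
      ≈⟨ +-congˡ (-‿cong (trans (altSum-e* i (deletions l)) (*-congˡ (∂≋∂Λ∘∏ l)))) ⟩
    prodE l +Λ -Λ (e i *Λ ∂Λ P)
      ≈⟨ +-cong (trans (reflexive (prodE≡∏ l)) (sym (*-identityˡ _))) (trans (-‿distribˡ-* _ _) (*-congʳ (sym (ι-DegreeOne (DegreeOne-e i))))) ⟩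
    1Λ *Λ P +Λ ι (e i) *Λ ∂Λ P
      ≈⟨ +-congʳ (*-congʳ (∂Λ-e i)) ⟨
    ∂Λ (e i) *Λ P +Λ ι (e i) *Λ ∂Λ P
      ≈⟨ ∂Λ-* (e i) P ⟨
    ∂Λ (e i *Λ P) ∎
    where
    open ≋-Reasoning
    P = ∏ (map e l)

  extend-∏ : ∀ {a b} (g : Fin a → Λ b) → (∀ i → DegreeOne (g i)) → ∀ l → extend g (∏ (map e l)) ≋ ∏ (map g l)
  extend-∏ g deg []      = extend-1 g
  extend-∏ g deg (i ∷ l) = trans (extend-* g deg (e i) _) (*-cong (extend-e g i) (extend-∏ g deg l))

  extend-∂ : ∀ {a b} (g : Fin a → Λ b) → (∀ i → Affine (g i)) → ∀ l → extend g (∂ l) ≋ ∂Λ (∏ (map g l))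
  extend-∂ g aff l = begin
    extend g (∂ l)                 ≈⟨ extend-cong g (∂≋∂Λ∘∏ l) ⟩
    extend g (∂Λ (∏ (map e l)))    ≈⟨ extend-∂Λ g aff _ ⟩
    ∂Λ (extend g (∏ (map e l)))    ≈⟨ ∂Λ-cong (extend-∏ g (proj₁ ∘ aff) l) ⟩
    ∂Λ (∏ (map g l))               ∎
    where open ≋-Reasoning

  swap-DegreeOne : ∀ {k} {a b : Λ k} → DegreeOne a → DegreeOne b → ∀ x → a *Λ (b *Λ x) ≋ -Λ (b *Λ (a *Λ x))
  swap-DegreeOne {a = a} {b} da db x = begin
    a *Λ (b *Λ x)        ≈⟨ *-assoc _ _ _ ⟨
    (a *Λ b) *Λ x        ≈⟨ *-congʳ (*-past-DegreeOne da b) ⟩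
    (ι b *Λ a) *Λ x      ≈⟨ *-congʳ (*-congʳ (ι-DegreeOne db)) ⟩
    ((-Λ b) *Λ a) *Λ x   ≈⟨ trans (*-assoc _ _ _) (sym (-‿distribˡ-* _ _)) ⟩
    -Λ (b *Λ (a *Λ x))   ∎
    where open ≋-Reasoning

  ∏-remove : ∀ {k r} (g : Fin r → Λ k) → (∀ i → DegreeOne (g i)) → ∀ (S : Subset r) {ε} → ε ∈ S →
             ∏ (map g (elems S)) ≈± g ε *Λ ∏ (map g (elems (S - ε)))
  ∏-remove g deg (true ∷ᵥ S) here =
    ≋⇒≈± (*-congˡ (reflexive (≡.cong (λ T → ∏ (map g (map suc (elems T)))) (≡.sym (p─⊥≡p S)))))
  ∏-remove g deg (true ∷ᵥ S) {suc ε} (there ε∈S) = begin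
    g zero *Λ ∏ (map g (map suc (elems S)))            ≡⟨ ≡.cong (λ l → g zero *Λ ∏ l) (≡.sym (map-∘ (elems S))) ⟩
    g zero *Λ ∏ (map g′ (elems S))                     ≈⟨ *ˡ-≈± (g zero) (∏-remove g′ (deg ∘ suc) S ε∈S) ⟩
    g zero *Λ (g′ ε *Λ R)                              ≈⟨ ≈±-neg (swap-DegreeOne (deg zero) (deg (suc ε)) R) ⟩
    g′ ε *Λ (g zero *Λ R)                              ≡⟨ ≡.cong (λ l → g′ ε *Λ (g zero *Λ ∏ l)) (map-∘ (elems (S - ε))) ⟩
    g′ ε *Λ (g zero *Λ ∏ (map g (map suc (elems (S - ε))))) ∎
    where
    open ≈±-Reasoning
    g′ = g ∘ suc
    R  = ∏ (map g′ (elems (S - ε)))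
  ∏-remove g deg (false ∷ᵥ S) {suc ε} (there ε∈S) = begin
    ∏ (map g (map suc (elems S)))               ≡⟨ ≡.cong ∏ (≡.sym (map-∘ (elems S))) ⟩
    ∏ (map (g ∘ suc) (elems S))                 ≈⟨ ∏-remove (g ∘ suc) (deg ∘ suc) S ε∈S ⟩
    g (suc ε) *Λ ∏ (map (g ∘ suc) (elems (S - ε)))      ≡⟨ ≡.cong (λ l → g (suc ε) *Λ ∏ l) (map-∘ (elems (S - ε))) ⟩
    g (suc ε) *Λ ∏ (map g (map suc (elems (S - ε))))    ∎
    where open ≈±-Reasoning

  ∂Λ-∏-map-translate : ∀ {a k} {A : Set a} {f g : A → Λ k} {t} → Direction t → (∀ x → Affine (g x)) →
                       (∀ x → f x ≋ g x +Λ t) → ∀ l → ∂Λ (∏ (map f l)) ≈± ∂Λ (∏ (map g l))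
  ∂Λ-∏-map-translate {f = f} {g} {t} dir aff f≋g+t l = begin
    ∂Λ (∏ (map f l))                 ≈⟨ ≋⇒≈± (∂Λ-cong (trans (∏-map-cong f≋g+t l) (reflexive (≡.cong ∏ (map-∘ l))))) ⟩
    ∂Λ (∏ (map (_+Λ t) (map g l)))   ≈⟨ ∂Λ-∏-translate dir (map⁺ (universal aff l)) ⟩
    ∂Λ (∏ (map g l))                 ∎
    where open ≈±-Reasoning

  ∂Λ-∏-map-rotate : ∀ {a k} {A : Set a} {g : A → Λ k} → (∀ x → DegreeOne (g x)) →
                    ∀ x l → ∂Λ (∏ (map g (x ∷ l))) ≈± ∂Λ (∏ (map g (l ∷ʳ x)))
  ∂Λ-∏-map-rotate {g = g} deg x l = begin
    ∂Λ (∏ (g x ∷ map g l))     ≈⟨ ∂Λ-≈± (∏-rotate (deg x) (map⁺ (universal deg l))) ⟩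
    ∂Λ (∏ (map g l ∷ʳ g x))    ≡⟨ ≡.cong (∂Λ ∘ ∏) (≡.sym (map-++ g l (x ∷ []))) ⟩
    ∂Λ (∏ (map g (l ∷ʳ x)))    ∎
    where open ≈±-Reasoning

  ∂Λ-Affine-* : ∀ {k} {a : Λ k} → Affine a → ∀ x → ∂Λ (a *Λ x) ≋ x -Λ a *Λ ∂Λ x
  ∂Λ-Affine-* {a = a} (da , ∂a) x = begin
    ∂Λ (a *Λ x)                   ≈⟨ ∂Λ-* a x ⟩
    ∂Λ a *Λ x +Λ ι a *Λ ∂Λ x      ≈⟨ +-cong (trans (*-congʳ ∂a) (*-identityˡ x)) (*-congʳ (ι-DegreeOne da)) ⟩
    x +Λ (-Λ a) *Λ ∂Λ x           ≈⟨ +-congˡ (-‿distribˡ-* a (∂Λ x)) ⟨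
    x -Λ a *Λ ∂Λ x                ∎
    where open ≋-Reasoning

module OrlikSolomonIdeals {c ℓ} (K : CommutativeRing c ℓ) where
  open import Data.Fin.Subset using (Subset)
  open import Data.Product using (_,_)
  open import Data.Sum using (inj₁; inj₂)
  open import Data.List using (map)
  open import Data.List.Relation.Unary.All.Properties using (map⁺)
  open import Data.List.Relation.Unary.All using (universal)

  open Exterior K
  open ExteriorRing K
  open GradedDerivation K
  open Substitution K
  open Products K

  module _ {k : ℕ} {C : Subset k → Set} where

    InI-≋ : ∀ {x y} → x ≋ y → InI C x → InI C y
    InI-≋ x≋y = resp (≋⇒≈Λ x≋y)

    InI-≋0 : ∀ {x} → x ≋ 0Λ → InI C x
    InI-≋0 x≋0 = InI-≋ (sym x≋0) zro

    InI-neg : ∀ {x} → InI C x → InI C (-Λ x)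
    InI-neg {x} x∈I = InI-≋ (trans (sym (-‿distribˡ-* 1Λ x)) (-‿cong (*-identityˡ x))) (mulˡ (-Λ 1Λ) x∈I)

    InI-≈± : ∀ {x y} → x ≈± y → InI C y → InI C x
    InI-≈± (inj₁ x≋y)  y∈I = InI-≋ (sym x≋y) y∈I
    InI-≈± (inj₂ x≋-y) y∈I = InI-≋ (sym x≋-y) (InI-neg y∈I)

    InI-circuit : ∀ S → C S → InI C (∂Λ (∏ (map e (elems S))))
    InI-circuit S CS = InI-≋ (∂≋∂Λ∘∏ (elems S)) (gen S CS)

  InI-image : ∀ {a b} {C : Subset a → Set} {C′ : Subset b → Set} (f : Λ a → Λ b) →
    (∀ {x y} → x ≋ y → f x ≋ f y) → (∀ x y → f (x +Λ y) ≋ f x +Λ f y) →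
    (∀ x y → f (x *Λ y) ≋ f x *Λ f y) → f 0Λ ≋ 0Λ →
    (∀ S → C S → InI C′ (f (∂ (elems S)))) → ∀ {x} → InI C x → InI C′ (f x)
  InI-image f cong f-+ f-* f-0 f-gen = go
    where
    go : ∀ {x} → InI _ x → InI _ (f x)
    go (gen S CS)   = f-gen S CS
    go zro          = InI-≋0 f-0
    go (add p q)    = InI-≋ (sym (f-+ _ _)) (add (go p) (go q))
    go (mulˡ a p)   = InI-≋ (sym (f-* _ _)) (mulˡ (f a) (go p))
    go (mulʳ a p)   = InI-≋ (sym (f-* _ _)) (mulʳ (f a) (go p))
    go (resp x≈y p) = InI-≋ (cong (≈Λ⇒≋ x≈y)) (go p)

  InI-ι : ∀ {k} {C : Subset k → Set} {x} → InI C x → InI C (ι x)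
  InI-ι {C = C} = InI-image ι ι-cong ι-+ ι-* ι-0 ι-gen
    where
    ι-gen : ∀ S → C S → InI C (ι (∂ (elems S)))
    ι-gen S CS = InI-≈± (begin
      ι (∂ (elems S))       ≈⟨ ≋⇒≈± (trans (ι-cong (∂≋∂Λ∘∏ (elems S))) (ι-∂Λ P)) ⟩
      -Λ ∂Λ (ι P)           ≈⟨ ≈±-neg refl ⟩
      ∂Λ (ι P)              ≈⟨ ∂Λ-≈± (ι-∏ (map⁺ (universal DegreeOne-e (elems S)))) ⟩
      ∂Λ P                  ∎) (InI-circuit S CS)
      where
      open ≈±-Reasoning
      P = ∏ (map e (elems S))

  InI-∂Λ : ∀ {k} {C : Subset k → Set} {x} → InI C x → InI C (∂Λ x)
  InI-∂Λ (gen S CS) = InI-≋0 (trans (∂Λ-cong (∂≋∂Λ∘∏ (elems S))) (∂Λ-∂Λ (∏ (map e (elems S)))))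
  InI-∂Λ zro = InI-≋0 ∂Λ-0
  InI-∂Λ (add {x} {y} p q) = InI-≋ (sym (∂Λ-+ x y)) (add (InI-∂Λ p) (InI-∂Λ q))
  InI-∂Λ (mulˡ a {x} p) = InI-≋ (sym (∂Λ-* a x)) (add (mulˡ (∂Λ a) p) (mulˡ (ι a) (InI-∂Λ p)))
  InI-∂Λ (mulʳ a {x} p) = InI-≋ (sym (∂Λ-* x a)) (add (mulʳ a (InI-∂Λ p)) (mulʳ (∂Λ a) (InI-ι p)))
  InI-∂Λ (resp {x} {y} x≈y p) = InI-≋ (∂Λ-cong {x = x} {y} (≈Λ⇒≋ x≈y)) (InI-∂Λ p)

  IsIsoOS-extend : ∀ {a b} {C : Subset a → Set} {C′ : Subset b → Set} (g : Fin a → Λ b) (h : Fin b → Λ a) →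
    (∀ i → DegreeOne (g i)) → (∀ j → DegreeOne (h j)) →
    (∀ i → extend h (g i) ≋ e i) → (∀ j → extend g (h j) ≋ e j) →
    (∀ S → C S → InI C′ (extend g (∂ (elems S)))) → (∀ S → C′ S → InI C (extend h (∂ (elems S)))) →
    IsIsoOS C C′ (extend g)
  IsIsoOS-extend g h deg-g deg-h hg≋e gh≋e g-gens h-gens =
    (λ x y x≡y → InI-≋ (extend-minus g x y) (g-ideal x≡y)) ,
    (λ x y gx≡gy → InI-≋ (trans (extend-minus h (extend g x) (extend g y)) (+-cong (hg≋id x) (-‿cong (hg≋id y)))) (h-ideal gx≡gy)) ,
    (λ y → extend h y , InI-≋0 (trans (+-congʳ (gh≋id y)) (-‿inverseʳ y)))
    where
    g-ideal = InI-image (extend g) (extend-cong g) (extend-+ g) (extend-* g deg-g) (extend-0 g) g-gens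
    h-ideal = InI-image (extend h) (extend-cong h) (extend-+ h) (extend-* h deg-h) (extend-0 h) h-gens
    hg≋id : ∀ x → extend h (extend g x) ≋ x
    hg≋id x = trans (extend-∘ h deg-h g x) (trans (extend-cong-gens hg≋e x) (extend-e-identity x))
    gh≋id : ∀ y → extend g (extend h y) ≋ y
    gh≋id y = trans (extend-∘ g deg-g h y) (trans (extend-cong-gens gh≋e y) (extend-e-identity y))

module Indexing where
  open import Data.Nat using (zero; suc; _+_)
  open import Data.Fin using (zero; suc; _↑ˡ_; _↑ʳ_; splitAt)
  open import Data.Fin.Properties using (join-splitAt)
  open import Data.Sum using ([_,_]; [_,_]′)
  open import Data.Fin.Subset using (Subset; ⊥; ⊤; ⁅_⁆; _∪_)
  open import Data.Fin.Subset.Properties using (∪-identityˡ; ∪-identityʳ)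
  open import Data.Vec using ([]; _∷_; _++_)
  open import Data.Bool using (true; false; if_then_else_)
  open import Data.List using (map) renaming ([] to []ₗ; _∷_ to _∷ₗ_; _++_ to _++ₗ_)
  open import Data.List.Properties using (map-++; map-∘; map-id; ++-identityʳ)
  open import Function using (id; _∘_)
  open import Relation.Binary.PropositionalEquality using (_≡_; refl; cong; cong₂; sym; trans; subst; module ≡-Reasoning)

  open ≡-Reasoning

  elems-⊥ : ∀ {r} → elems (⊥ {r}) ≡ []ₗ
  elems-⊥ {zero}  = refl
  elems-⊥ {suc r} = cong (map suc) (elems-⊥ {r})

  elems-⁅⁆ : ∀ {r} (i : Fin r) → elems ⁅ i ⁆ ≡ i ∷ₗ []ₗ
  elems-⁅⁆ zero    = cong (λ l → zero ∷ₗ map suc l) elems-⊥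
  elems-⁅⁆ (suc i) = cong (map suc) (elems-⁅⁆ i)

  elems-++ : ∀ {k m} (A : Subset k) (B : Subset m) → elems (A ++ B) ≡ map (_↑ˡ m) (elems A) ++ₗ map (k ↑ʳ_) (elems B)
  map-suc-elems-++ : ∀ {k m} (A : Subset k) (B : Subset m) →
                     map suc (elems (A ++ B)) ≡ map (_↑ˡ m) (map suc (elems A)) ++ₗ map (suc k ↑ʳ_) (elems B)

  elems-++ []          B = sym (map-id (elems B))
  elems-++ (true ∷ A)  B = cong (zero ∷ₗ_) (map-suc-elems-++ A B)
  elems-++ (false ∷ A) B = map-suc-elems-++ A B

  map-suc-elems-++ {k} {m} A B = begin
    map suc (elems (A ++ B))                                                  ≡⟨ cong (map suc) (elems-++ A B) ⟩
    map suc (map (_↑ˡ m) (elems A) ++ₗ map (k ↑ʳ_) (elems B))                ≡⟨ map-++ suc (map (_↑ˡ m) (elems A)) _ ⟩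
    map suc (map (_↑ˡ m) (elems A)) ++ₗ map suc (map (k ↑ʳ_) (elems B))      ≡⟨ cong₂ _++ₗ_ (trans (sym (map-∘ (elems A))) (map-∘ (elems A))) (sym (map-∘ (elems B))) ⟩
    map (_↑ˡ m) (map suc (elems A)) ++ₗ map (suc k ↑ʳ_) (elems B)            ∎

  elems-++⊥ : ∀ {k m} (A : Subset k) → elems (A ++ ⊥ {m}) ≡ map (_↑ˡ m) (elems A)
  elems-++⊥ {k} {m} A = begin
    elems (A ++ ⊥)                                            ≡⟨ elems-++ A ⊥ ⟩
    map (_↑ˡ m) (elems A) ++ₗ map (k ↑ʳ_) (elems (⊥ {m}))     ≡⟨ cong (λ l → map (_↑ˡ m) (elems A) ++ₗ map (k ↑ʳ_) l) elems-⊥ ⟩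
    map (_↑ˡ m) (elems A) ++ₗ []ₗ                              ≡⟨ ++-identityʳ _ ⟩
    map (_↑ˡ m) (elems A)                                     ∎

  elems-⊥++ : ∀ {k m} (B : Subset m) → elems (⊥ {k} ++ B) ≡ map (k ↑ʳ_) (elems B)
  elems-⊥++ {k} {m} B = trans (elems-++ ⊥ B) (cong (λ l → map (_↑ˡ m) l ++ₗ map (k ↑ʳ_) (elems B)) (elems-⊥ {k}))

  private
    image-suc : ∀ {a b} (f : Fin a → Fin b) S → image (λ i → suc (f i)) S ≡ false ∷ image f S
    image-suc f []      = refl
    image-suc f (x ∷ S) rewrite image-suc (λ i → f (suc i)) S with x
    ... | true  = refl
    ... | false = refl

    image-id : ∀ {r} (S : Subset r) → image id S ≡ S
    image-id []      = refl
    image-id (x ∷ S) = begin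
      (if x then ⁅ zero ⁆ else ⊥) ∪ image suc S      ≡⟨ cong (_ ∪_) (trans (image-suc id S) (cong (false ∷_) (image-id S))) ⟩
      (if x then ⁅ zero ⁆ else ⊥) ∪ (false ∷ S)      ≡⟨ head-∪ x ⟩
      x ∷ S                                          ∎
      where
      head-∪ : ∀ x → (if x then ⁅ zero ⁆ else ⊥) ∪ (false ∷ S) ≡ x ∷ S
      head-∪ true  = cong (true ∷_) (∪-identityˡ S)
      head-∪ false = cong (false ∷_) (∪-identityˡ S)

    ⁅↑ʳ⁆ : ∀ k {m} (ε : Fin m) → ⁅ k ↑ʳ ε ⁆ ≡ ⊥ {k} ++ ⁅ ε ⁆
    ⁅↑ʳ⁆ zero    ε = refl
    ⁅↑ʳ⁆ (suc k) ε = cong (false ∷_) (⁅↑ʳ⁆ k ε)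

    ∪-++ : ∀ {k m} (A A′ : Subset k) (B B′ : Subset m) → (A ++ B) ∪ (A′ ++ B′) ≡ (A ∪ A′) ++ (B ∪ B′)
    ∪-++ []      []       B B′ = refl
    ∪-++ (x ∷ A) (y ∷ A′) B B′ = cong (_ ∷_) (∪-++ A A′ B B′)

  image-cls-⊤ : ∀ {n₁ m} (ε₀ : Fin m) → image (cls {suc n₁} ε₀) (⊤ ++ ⊥ {m}) ≡ ⊤ {n₁} ++ ⁅ ε₀ ⁆
  image-cls-⊤ {n₁} {m} ε₀ = begin
    ⁅ n₁ ↑ʳ ε₀ ⁆ ∪ image id (⊤ {n₁} ++ ⊥ {m})    ≡⟨ cong₂ _∪_ (⁅↑ʳ⁆ n₁ ε₀) (image-id (⊤ {n₁} ++ ⊥)) ⟩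
    (⊥ {n₁} ++ ⁅ ε₀ ⁆) ∪ (⊤ {n₁} ++ ⊥)          ≡⟨ ∪-++ (⊥ {n₁}) ⊤ ⁅ ε₀ ⁆ ⊥ ⟩
    (⊥ ∪ ⊤ {n₁}) ++ (⁅ ε₀ ⁆ ∪ ⊥)                 ≡⟨ cong₂ _++_ (∪-identityˡ ⊤) (∪-identityʳ ⁅ ε₀ ⁆) ⟩
    ⊤ ++ ⁅ ε₀ ⁆                                  ∎

  image-cls-⊥ : ∀ {n₁ m} (ε₀ : Fin m) (C : Subset m) → image (cls {suc n₁} ε₀) (⊥ ++ C) ≡ ⊥ {n₁} ++ C
  image-cls-⊥ {n₁} ε₀ C = trans (∪-identityˡ _) (image-id (⊥ {n₁} ++ C))

  image-cls-remove1 : ∀ {n₁ m} (ε₀ : Fin m) (C : Subset m) →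
    image (cls {suc n₁} ε₀) (remove1 ⊤ ++ ⊥ {m}) ∪ image (cls {suc n₁} ε₀) (⊥ ++ C) ≡ ⊤ {n₁} ++ C
  image-cls-remove1 {n₁} {m} ε₀ C = begin
    (⊥ ∪ image id (⊤ {n₁} ++ ⊥ {m})) ∪ image (cls {suc n₁} ε₀) (⊥ ++ C)
      ≡⟨ cong₂ _∪_ (trans (∪-identityˡ _) (image-id (⊤ {n₁} ++ ⊥))) (image-cls-⊥ ε₀ C) ⟩
    (⊤ {n₁} ++ ⊥) ∪ (⊥ ++ C)    ≡⟨ ∪-++ (⊤ {n₁}) ⊥ ⊥ C ⟩
    (⊤ {n₁} ∪ ⊥) ++ (⊥ ∪ C)     ≡⟨ cong₂ _++_ (∪-identityʳ ⊤) (∪-identityˡ C) ⟩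
    ⊤ ++ C                 ∎

  ↑-elim : ∀ {a} k {m} {P : Fin (k + m) → Set a} → (∀ i → P (i ↑ˡ m)) → (∀ j → P (k ↑ʳ j)) → ∀ x → P x
  ↑-elim k {m} {P} left right x = subst P (join-splitAt k m x) ([_,_] {C = P ∘ [ _↑ˡ m , k ↑ʳ_ ]′} left right (splitAt k x))

module ParallelConnection {c ℓ} (K : CommutativeRing c ℓ) {n₁ m : ℕ} (ε₀ : Fin m) where
  open import Level using (_⊔_)
  open import Data.Nat using (zero; suc; _+_)
  open import Data.Fin using (zero; suc; _↑ˡ_; _↑ʳ_; fromℕ; splitAt)
  open import Data.Fin.Properties using (splitAt-↑ˡ; splitAt-↑ʳ)
  open import Data.Fin.Subset using (Subset; ⊤; ⊥; ⁅_⁆; _∈_; _-_)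
  open import Data.Bool using (true; false)
  open import Data.Sum using ([_,_]′; inj₁; inj₂)
  open import Data.Product using (_,_; proj₁)
  open import Data.Vec using (_++_) renaming ([] to []ᵥ; _∷_ to _∷ᵥ_)
  open import Data.List using (List; map; [_]; _∷ʳ_) renaming (_∷_ to _∷ₗ_; _++_ to _++ₗ_)
  open import Data.List.Properties using (map-++; map-∘; map-cong)
  open import Data.List.Relation.Unary.All using (universal)
  open import Data.List.Relation.Unary.All.Properties using (map⁺)
  open import Function using (_∘_)
  open import Relation.Binary.PropositionalEquality as ≡ using (_≡_; subst)

  open Exterior K
  open ExteriorRing K
  open GradedDerivation K
  open Substitution K
  open Products K
  open OrlikSolomonIdeals K
  open Indexing

  private
    n = suc n₁

  last : Fin n
  last = fromℕ n₁

  isLast⇒≡last : ∀ {r} (i : Fin (suc r)) → isLast {n} {m} ε₀ i ≡ true → i ≡ fromℕ r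
  isLast⇒≡last {zero}  zero    _  = ≡.refl
  isLast⇒≡last {suc r} (suc i) eq = ≡.cong suc (isLast⇒≡last i eq)

  eᵢ : Fin n → Λ (n + m)
  eᵢ i = e (i ↑ˡ m)

  cl : Fin n → Fin (n₁ + m)
  cl i = cls {n} ε₀ (i ↑ˡ m)

  ē′ : Fin (n₁ + m) → Λ (n₁ + m + 1)
  ē′ = ē {n} {m} ε₀

  eₚ′ : Λ (n₁ + m + 1)
  eₚ′ = eₚ {n} {m} ε₀

  c₀ : Λ (n + m)
  c₀ = e (n ↑ʳ ε₀)

  ψgen : Fin (n₁ + m + 1) → Λ (n + m)
  ψgen = [ on-classes ∘ splitAt n₁ , (λ _ → eᵢ last) ]′ ∘ splitAt (n₁ + m)
    where
    on-classes = [ (λ j → (eᵢ (suc j) -Λ eᵢ zero) +Λ c₀) , (λ ε → e (n ↑ʳ ε)) ]′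

  -- On [n], φ and ψ are translations of the identification of [n] with its classes.
  t : Λ (n₁ + m + 1)
  t = eₚ′ -Λ ē′ (cl last)

  t′ : Λ (n + m)
  t′ = c₀ -Λ eᵢ zero

  φgen-[n] : ∀ i → φgen {n} {m} ε₀ i ≋ ē′ (cl i) +Λ t
  φgen-[n] i with isLast {n} {m} ε₀ i in eq
  ... | true  rewrite isLast⇒≡last i eq = solve v₀ (v₁ ⊕ (v₀ ⊖ v₁)) (eₚ′ ∷ᵥ ē′ (cl last) ∷ᵥ []ᵥ)
  ... | false = solve ((v₀ ⊖ v₁) ⊕ v₂) (v₀ ⊕ (v₂ ⊖ v₁)) (ē′ (cl i) ∷ᵥ ē′ (cl last) ∷ᵥ eₚ′ ∷ᵥ []ᵥ)

  φ̂gen′ : Fin (n + m) → Λ (n₁ + m + 1)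
  φ̂gen′ = φ̂gen {n} {m} ε₀

  φ̂gen-[n] : ∀ i → φ̂gen′ (i ↑ˡ m) ≋ ē′ (cl i) +Λ t
  φ̂gen-[n] i rewrite splitAt-↑ˡ n i m = φgen-[n] i

  φ̂gen-E₀ : ∀ ε → φ̂gen′ (n ↑ʳ ε) ≡ ē′ (n₁ ↑ʳ ε)
  φ̂gen-E₀ ε rewrite splitAt-↑ʳ n m ε = ≡.refl

  ψgen-class : ∀ j → ψgen ((j ↑ˡ m) ↑ˡ 1) ≡ (eᵢ (suc j) -Λ eᵢ zero) +Λ c₀
  ψgen-class j rewrite splitAt-↑ˡ (n₁ + m) (j ↑ˡ m) 1 | splitAt-↑ˡ n₁ j m = ≡.refl

  ψgen-E₀ : ∀ ε → ψgen ((n₁ ↑ʳ ε) ↑ˡ 1) ≡ e (n ↑ʳ ε)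
  ψgen-E₀ ε rewrite splitAt-↑ˡ (n₁ + m) (n₁ ↑ʳ ε) 1 | splitAt-↑ʳ n₁ m ε = ≡.refl

  ψgen-p : ψgen ((n₁ + m) ↑ʳ zero) ≡ eᵢ last
  ψgen-p rewrite splitAt-↑ʳ (n₁ + m) 1 zero = ≡.refl

  ψgen-[n] : ∀ i → ψgen (cl i ↑ˡ 1) ≋ eᵢ i +Λ t′
  ψgen-[n] zero    rewrite ψgen-E₀ ε₀ = solve v₀ (v₁ ⊕ (v₀ ⊖ v₁)) (c₀ ∷ᵥ eᵢ zero ∷ᵥ []ᵥ)
  ψgen-[n] (suc j) rewrite ψgen-class j = solve ((v₀ ⊖ v₁) ⊕ v₂) (v₀ ⊕ (v₂ ⊖ v₁)) (eᵢ (suc j) ∷ᵥ eᵢ zero ∷ᵥ c₀ ∷ᵥ []ᵥ)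

  t-Direction : Direction t
  t-Direction = Affine-− (Affine-e ((n₁ + m) ↑ʳ zero)) (Affine-e (cl last ↑ˡ 1))

  t′-Direction : Direction t′
  t′-Direction = Affine-− (Affine-e (n ↑ʳ ε₀)) (Affine-e (zero ↑ˡ m))

  φ̂gen-Affine : ∀ i → Affine (φ̂gen′ i)
  φ̂gen-Affine = ↑-elim n (λ i → Affine-resp (sym (φ̂gen-[n] i)) (Affine-+ (Affine-e (cl i ↑ˡ 1)) t-Direction))
                         (λ ε → subst Affine (≡.sym (φ̂gen-E₀ ε)) (Affine-e ((n₁ ↑ʳ ε) ↑ˡ 1)))

  ψgen-Affine : ∀ q → Affine (ψgen q)
  ψgen-Affine = ↑-elim (n₁ + m) (↑-elim n₁ (λ j → Affine-resp (sym (ψgen-[n] (suc j))) (Affine-+ (Affine-e (suc j ↑ˡ m)) t′-Direction))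
                                           (λ ε → subst Affine (≡.sym (ψgen-E₀ ε)) (Affine-e (n ↑ʳ ε))))
                                (λ { zero → subst Affine (≡.sym ψgen-p) (Affine-e (last ↑ˡ m)) })

  φ̂-t′ : extend φ̂gen′ t′ ≋ -Λ t
  φ̂-t′ = begin
    extend φ̂gen′ (c₀ -Λ eᵢ zero)               ≈⟨ extend-minus φ̂gen′ c₀ (eᵢ zero) ⟩
    extend φ̂gen′ c₀ -Λ extend φ̂gen′ (eᵢ zero)  ≈⟨ +-cong (trans (extend-e φ̂gen′ (n ↑ʳ ε₀)) (reflexive (φ̂gen-E₀ ε₀))) (-‿cong (trans (extend-e φ̂gen′ (zero ↑ˡ m)) (φ̂gen-[n] zero))) ⟩
    ē′ (cl zero) -Λ (ē′ (cl zero) +Λ t)          ≈⟨ solve (v₀ ⊖ (v₀ ⊕ v₁)) (⊝ v₁) (ē′ (cl zero) ∷ᵥ t ∷ᵥ []ᵥ) ⟩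
    -Λ t                                        ∎
    where open ≋-Reasoning

  ψ̂-t : extend ψgen t ≋ -Λ t′
  ψ̂-t = begin
    extend ψgen (eₚ′ -Λ ē′ (cl last))            ≈⟨ extend-minus ψgen eₚ′ (ē′ (cl last)) ⟩
    extend ψgen eₚ′ -Λ extend ψgen (ē′ (cl last)) ≈⟨ +-cong (trans (extend-e ψgen ((n₁ + m) ↑ʳ zero)) (reflexive ψgen-p)) (-‿cong (trans (extend-e ψgen (cl last ↑ˡ 1)) (ψgen-[n] last))) ⟩
    eᵢ last -Λ (eᵢ last +Λ t′)                   ≈⟨ solve (v₀ ⊖ (v₀ ⊕ v₁)) (⊝ v₁) (eᵢ last ∷ᵥ t′ ∷ᵥ []ᵥ) ⟩
    -Λ t′                                        ∎
    where open ≋-Reasoning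

  ψ̂∘φ̂≋id : ∀ i → extend ψgen (φ̂gen′ i) ≋ e i
  ψ̂∘φ̂≋id = ↑-elim n on-[n] on-E₀
    where
    open ≋-Reasoning
    on-[n] : ∀ i → extend ψgen (φ̂gen′ (i ↑ˡ m)) ≋ eᵢ i
    on-[n] i = begin
      extend ψgen (φ̂gen′ (i ↑ˡ m))             ≈⟨ extend-cong ψgen (φ̂gen-[n] i) ⟩
      extend ψgen (ē′ (cl i) +Λ t)             ≈⟨ extend-+ ψgen (ē′ (cl i)) t ⟩
      extend ψgen (ē′ (cl i)) +Λ extend ψgen t ≈⟨ +-cong (trans (extend-e ψgen (cl i ↑ˡ 1)) (ψgen-[n] i)) ψ̂-t ⟩
      (eᵢ i +Λ t′) +Λ -Λ t′                    ≈⟨ solve ((v₀ ⊕ v₁) ⊖ v₁) v₀ (eᵢ i ∷ᵥ t′ ∷ᵥ []ᵥ) ⟩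
      eᵢ i                                     ∎
    on-E₀ : ∀ ε → extend ψgen (φ̂gen′ (n ↑ʳ ε)) ≋ e (n ↑ʳ ε)
    on-E₀ ε = begin
      extend ψgen (φ̂gen′ (n ↑ʳ ε))   ≡⟨ ≡.cong (extend ψgen) (φ̂gen-E₀ ε) ⟩
      extend ψgen (ē′ (n₁ ↑ʳ ε))     ≈⟨ extend-e ψgen ((n₁ ↑ʳ ε) ↑ˡ 1) ⟩
      ψgen ((n₁ ↑ʳ ε) ↑ˡ 1)          ≡⟨ ψgen-E₀ ε ⟩
      e (n ↑ʳ ε)                     ∎

  φ̂∘ψ̂≋id : ∀ q → extend φ̂gen′ (ψgen q) ≋ e q
  φ̂∘ψ̂≋id = ↑-elim (n₁ + m) (↑-elim n₁ (λ j → on-[n] (suc j)) on-E₀) (λ { zero → on-p })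
    where
    open ≋-Reasoning
    on-[n] : ∀ i → extend φ̂gen′ (ψgen (cl i ↑ˡ 1)) ≋ ē′ (cl i)
    on-[n] i = begin
      extend φ̂gen′ (ψgen (cl i ↑ˡ 1))         ≈⟨ extend-cong φ̂gen′ (ψgen-[n] i) ⟩
      extend φ̂gen′ (eᵢ i +Λ t′)               ≈⟨ extend-+ φ̂gen′ (eᵢ i) t′ ⟩
      extend φ̂gen′ (eᵢ i) +Λ extend φ̂gen′ t′ ≈⟨ +-cong (trans (extend-e φ̂gen′ (i ↑ˡ m)) (φ̂gen-[n] i)) φ̂-t′ ⟩
      (ē′ (cl i) +Λ t) +Λ -Λ t                ≈⟨ solve ((v₀ ⊕ v₁) ⊖ v₁) v₀ (ē′ (cl i) ∷ᵥ t ∷ᵥ []ᵥ) ⟩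
      ē′ (cl i)                               ∎
    on-E₀ : ∀ ε → extend φ̂gen′ (ψgen ((n₁ ↑ʳ ε) ↑ˡ 1)) ≋ ē′ (n₁ ↑ʳ ε)
    on-E₀ ε = begin
      extend φ̂gen′ (ψgen ((n₁ ↑ʳ ε) ↑ˡ 1)) ≡⟨ ≡.cong (extend φ̂gen′) (ψgen-E₀ ε) ⟩
      extend φ̂gen′ (e (n ↑ʳ ε))            ≈⟨ extend-e φ̂gen′ (n ↑ʳ ε) ⟩
      φ̂gen′ (n ↑ʳ ε)                       ≡⟨ φ̂gen-E₀ ε ⟩
      ē′ (n₁ ↑ʳ ε)                         ∎
    on-p : extend φ̂gen′ (ψgen ((n₁ + m) ↑ʳ zero)) ≋ eₚ′
    on-p = begin
      extend φ̂gen′ (ψgen ((n₁ + m) ↑ʳ zero))  ≡⟨ ≡.cong (extend φ̂gen′) ψgen-p ⟩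
      extend φ̂gen′ (eᵢ last)                  ≈⟨ trans (extend-e φ̂gen′ (last ↑ˡ m)) (φ̂gen-[n] last) ⟩
      ē′ (cl last) +Λ t                       ≈⟨ solve (v₀ ⊕ (v₁ ⊖ v₀)) v₁ (ē′ (cl last) ∷ᵥ eₚ′ ∷ᵥ []ᵥ) ⟩
      eₚ′                                     ∎

  -- [n] listed as 1 ∷ R, and the type-1 circuit of P^n_{ε₀} (the classes of [n]) listed as R ∷ʳ 1.
  R : List (Fin n)
  R = map suc (elems (⊤ {n₁}))

  elems-Cₙ : elems (⊤ {n} ++ ⊥ {m}) ≡ map (_↑ˡ m) (zero ∷ₗ R)
  elems-Cₙ = elems-++⊥ {n} {m} ⊤

  elems-classes-Cₙ : elems ((⊤ {n₁} ++ ⁅ ε₀ ⁆) ++ ⊥ {1}) ≡ map (λ i → cl i ↑ˡ 1) (R ∷ʳ zero)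
  elems-classes-Cₙ = begin
    elems ((⊤ {n₁} ++ ⁅ ε₀ ⁆) ++ ⊥ {1})
      ≡⟨ elems-++⊥ (⊤ {n₁} ++ ⁅ ε₀ ⁆) ⟩
    map (_↑ˡ 1) (elems (⊤ {n₁} ++ ⁅ ε₀ ⁆))
      ≡⟨ ≡.cong (map (_↑ˡ 1)) (≡.trans (elems-++ (⊤ {n₁}) ⁅ ε₀ ⁆) (≡.cong (λ l → map (_↑ˡ m) (elems (⊤ {n₁})) ++ₗ map (n₁ ↑ʳ_) l) (elems-⁅⁆ ε₀))) ⟩
    map (_↑ˡ 1) (map (_↑ˡ m) (elems (⊤ {n₁})) ++ₗ [ n₁ ↑ʳ ε₀ ])
      ≡⟨ map-++ (_↑ˡ 1) (map (_↑ˡ m) (elems (⊤ {n₁}))) _ ⟩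
    map (_↑ˡ 1) (map (_↑ˡ m) (elems (⊤ {n₁}))) ++ₗ [ (n₁ ↑ʳ ε₀) ↑ˡ 1 ]
      ≡⟨ ≡.cong (_++ₗ [ (n₁ ↑ʳ ε₀) ↑ˡ 1 ]) (≡.trans (≡.sym (map-∘ (elems (⊤ {n₁})))) (map-∘ (elems (⊤ {n₁})))) ⟩
    map (λ i → cl i ↑ˡ 1) R ++ₗ [ cl zero ↑ˡ 1 ]
      ≡⟨ map-++ (λ i → cl i ↑ˡ 1) R [ zero ] ⟨
    map (λ i → cl i ↑ˡ 1) (R ∷ʳ zero) ∎
    where open ≡.≡-Reasoning

  module Circuits (M₀ : SimpleMatroid m) where
    private
      CM  = MCircuit n M₀
      CM′ = M′Circuit n M₀ ε₀

      ψ̂-class-circuit : Subset (n₁ + m) → Set (c ⊔ ℓ)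
      ψ̂-class-circuit D = InI CM (extend ψgen (∂ (elems (D ++ ⊥ {1}))))

    φ̂-Cₙ : InI CM′ (extend φ̂gen′ (∂ (elems (⊤ {n} ++ ⊥ {m}))))
    φ̂-Cₙ = InI-≈± (begin
      extend φ̂gen′ (∂ (elems (⊤ {n} ++ ⊥ {m})))       ≈⟨ ≋⇒≈± (extend-∂ φ̂gen′ φ̂gen-Affine (elems (⊤ {n} ++ ⊥ {m}))) ⟩
      ∂Λ (∏ (map φ̂gen′ (elems (⊤ {n} ++ ⊥ {m}))))     ≡⟨ ≡.cong (∂Λ ∘ ∏) (≡.trans (≡.cong (map φ̂gen′) elems-Cₙ) (≡.sym (map-∘ (zero ∷ₗ R)))) ⟩
      ∂Λ (∏ (map (φ̂gen′ ∘ (_↑ˡ m)) (zero ∷ₗ R)))      ≈⟨ ∂Λ-∏-map-translate t-Direction (λ i → Affine-e (cl i ↑ˡ 1)) φ̂gen-[n] (zero ∷ₗ R) ⟩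
      ∂Λ (∏ (map (ē′ ∘ cl) (zero ∷ₗ R)))              ≈⟨ ∂Λ-∏-map-rotate (λ i → DegreeOne-e (cl i ↑ˡ 1)) zero R ⟩
      ∂Λ (∏ (map (ē′ ∘ cl) (R ∷ʳ zero)))              ≡⟨ ≡.cong (∂Λ ∘ ∏) (≡.trans (map-∘ (R ∷ʳ zero)) (≡.cong (map e) (≡.sym elems-classes-Cₙ))) ⟩
      ∂Λ (∏ (map e (elems S′)))                       ∎) (InI-circuit S′ S′-circuit)
      where
      open ≈±-Reasoning
      S′ = (⊤ {n₁} ++ ⁅ ε₀ ⁆) ++ ⊥ {1}
      S′-circuit : CM′ S′
      S′-circuit = (⊤ ++ ⁅ ε₀ ⁆) , inj₁ (⊤ , ≡.refl , ≡.sym (image-cls-⊤ ε₀)) , ≡.refl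

    φ̂-E₀ : ∀ C → SimpleMatroid.Circuit M₀ C → InI CM′ (extend φ̂gen′ (∂ (elems (⊥ {n} ++ C))))
    φ̂-E₀ C CC = InI-≋ (sym (begin
      extend φ̂gen′ (∂ (elems (⊥ {n} ++ C)))        ≈⟨ extend-∂ φ̂gen′ φ̂gen-Affine (elems (⊥ {n} ++ C)) ⟩
      ∂Λ (∏ (map φ̂gen′ (elems (⊥ {n} ++ C))))      ≡⟨ ≡.cong (∂Λ ∘ ∏) (≡.trans (≡.cong (map φ̂gen′) (elems-⊥++ C)) (≡.sym (map-∘ (elems C)))) ⟩
      ∂Λ (∏ (map (φ̂gen′ ∘ (n ↑ʳ_)) (elems C)))     ≡⟨ ≡.cong (∂Λ ∘ ∏) (map-cong φ̂gen-E₀ (elems C)) ⟩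
      ∂Λ (∏ (map (λ ε → ē′ (n₁ ↑ʳ ε)) (elems C)))  ≡⟨ ≡.cong (∂Λ ∘ ∏) (≡.trans (map-∘ (elems C)) (≡.cong (map e) (≡.sym S′-elems))) ⟩
      ∂Λ (∏ (map e (elems S′)))                    ∎)) (InI-circuit S′ S′-circuit)
      where
      open ≋-Reasoning
      S′ = (⊥ {n₁} ++ C) ++ ⊥ {1}
      S′-elems : elems S′ ≡ map (λ ε → (n₁ ↑ʳ ε) ↑ˡ 1) (elems C)
      S′-elems = ≡.trans (elems-++⊥ (⊥ {n₁} ++ C)) (≡.trans (≡.cong (map (_↑ˡ 1)) (elems-⊥++ C)) (≡.sym (map-∘ (elems C))))
      S′-circuit : CM′ S′
      S′-circuit = (⊥ ++ C) , inj₂ (inj₁ (C , CC , ≡.sym (image-cls-⊥ ε₀ C))) , ≡.refl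

    φ̂-circuits : ∀ S → CM S → InI CM′ (extend φ̂gen′ (∂ (elems S)))
    φ̂-circuits _ (inj₁ (_ , ≡.refl , ≡.refl)) = φ̂-Cₙ
    φ̂-circuits _ (inj₂ (C , CC , ≡.refl))     = φ̂-E₀ C CC

    Cₙ-rotated : InI CM (∂Λ (∏ (map eᵢ (R ∷ʳ zero))))
    Cₙ-rotated = InI-≈± (begin
      ∂Λ (∏ (map eᵢ (R ∷ʳ zero)))             ≈⟨ ∂Λ-∏-map-rotate (λ i → DegreeOne-e (i ↑ˡ m)) zero R ⟨
      ∂Λ (∏ (map eᵢ (zero ∷ₗ R)))             ≡⟨ ≡.cong (∂Λ ∘ ∏) (≡.trans (map-∘ (zero ∷ₗ R)) (≡.cong (map e) (≡.sym elems-Cₙ))) ⟩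
      ∂Λ (∏ (map e (elems (⊤ {n} ++ ⊥ {m})))) ∎) (InI-circuit (⊤ {n} ++ ⊥ {m}) (inj₁ (⊤ , ≡.refl , ≡.refl)))
      where open ≈±-Reasoning

    ψ̂-Cₙ : InI CM (extend ψgen (∂ (elems ((⊤ {n₁} ++ ⁅ ε₀ ⁆) ++ ⊥ {1}))))
    ψ̂-Cₙ = InI-≈± (begin
      extend ψgen (∂ (elems S′))                      ≈⟨ ≋⇒≈± (extend-∂ ψgen ψgen-Affine (elems S′)) ⟩
      ∂Λ (∏ (map ψgen (elems S′)))                    ≡⟨ ≡.cong (∂Λ ∘ ∏) (≡.trans (≡.cong (map ψgen) elems-classes-Cₙ) (≡.sym (map-∘ (R ∷ʳ zero)))) ⟩
      ∂Λ (∏ (map (λ i → ψgen (cl i ↑ˡ 1)) (R ∷ʳ zero))) ≈⟨ ∂Λ-∏-map-translate t′-Direction (λ i → Affine-e (i ↑ˡ m)) ψgen-[n] (R ∷ʳ zero) ⟩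
      ∂Λ (∏ (map eᵢ (R ∷ʳ zero)))                     ∎) Cₙ-rotated
      where
      open ≈±-Reasoning
      S′ = (⊤ {n₁} ++ ⁅ ε₀ ⁆) ++ ⊥ {1}

    B : Λ (n + m)
    B = ∏ (map (λ j → eᵢ (suc j) -Λ eᵢ zero) (elems (⊤ {n₁})))

    B∈I : InI CM B
    B∈I = InI-≈± (begin
      B                                        ≡⟨ ≡.cong ∏ (≡.trans (map-∘ (elems (⊤ {n₁}))) (≡.cong (map (_-Λ eᵢ zero)) (map-∘ (elems (⊤ {n₁}))))) ⟩
      ∏ (map (_-Λ eᵢ zero) (map eᵢ R))         ≈⟨ ∂Λ-∏-∷ʳ (map⁺ (universal (λ i → Affine-e (i ↑ˡ m)) R)) (Affine-e (zero ↑ˡ m)) ⟨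
      ∂Λ (∏ (map eᵢ R ∷ʳ eᵢ zero))             ≡⟨ ≡.cong (∂Λ ∘ ∏) (≡.sym (map-++ eᵢ R [ zero ])) ⟩
      ∂Λ (∏ (map eᵢ (R ∷ʳ zero)))              ∎) Cₙ-rotated
      where open ≈±-Reasoning

    ψ̂-E₀ : ∀ C → SimpleMatroid.Circuit M₀ C → InI CM (extend ψgen (∂ (elems ((⊥ {n₁} ++ C) ++ ⊥ {1}))))
    ψ̂-E₀ C CC = InI-≋ (sym (begin
      extend ψgen (∂ (elems S′))                         ≈⟨ extend-∂ ψgen ψgen-Affine (elems S′) ⟩
      ∂Λ (∏ (map ψgen (elems S′)))                       ≡⟨ ≡.cong (∂Λ ∘ ∏) (≡.trans (≡.cong (map ψgen) S′-elems) (≡.sym (map-∘ (elems C)))) ⟩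
      ∂Λ (∏ (map (λ ε → ψgen ((n₁ ↑ʳ ε) ↑ˡ 1)) (elems C))) ≡⟨ ≡.cong (∂Λ ∘ ∏) (≡.trans (map-cong ψgen-E₀ (elems C)) (map-∘ (elems C))) ⟩
      ∂Λ (∏ (map e (map (n ↑ʳ_) (elems C))))             ≡⟨ ≡.cong (∂Λ ∘ ∏ ∘ map e) (elems-⊥++ C) ⟨
      ∂Λ (∏ (map e (elems (⊥ {n} ++ C))))                ∎)) (InI-circuit (⊥ {n} ++ C) (inj₂ (C , CC , ≡.refl)))
      where
      open ≋-Reasoning
      S′ = (⊥ {n₁} ++ C) ++ ⊥ {1}
      S′-elems : elems S′ ≡ map (λ ε → (n₁ ↑ʳ ε) ↑ˡ 1) (elems C)
      S′-elems = ≡.trans (elems-++⊥ (⊥ {n₁} ++ C)) (≡.trans (≡.cong (map (_↑ˡ 1)) (elems-⊥++ C)) (≡.sym (map-∘ (elems C))))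

    -- c₀ Q is ± the product over C′, so Q − c₀ ∂Q = ∂(c₀ Q) lies in I(M); and P c₀ = B c₀.
    ψ̂-joined : ∀ C′ → SimpleMatroid.Circuit M₀ C′ → ε₀ ∈ C′ →
               InI CM (extend ψgen (∂ (elems ((⊤ {n₁} ++ (C′ - ε₀)) ++ ⊥ {1}))))
    ψ̂-joined C′ CC′ ε₀∈C′ = InI-≋ (sym ψ̂-∂≋∂PQ) (InI-∂Λ PQ∈I)
      where
      S′ = (⊤ {n₁} ++ (C′ - ε₀)) ++ ⊥ {1}
      bs = map (λ j → eᵢ (suc j) -Λ eᵢ zero) (elems (⊤ {n₁}))
      Q  = ∏ (map (λ ε → e (n ↑ʳ ε)) (elems (C′ - ε₀)))
      P  = ∏ (map (_+Λ c₀) bs)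

      ψgen-S′ : map ψgen (elems S′) ≡ map (_+Λ c₀) bs ++ₗ map (λ ε → e (n ↑ʳ ε)) (elems (C′ - ε₀))
      ψgen-S′ = begin
        map ψgen (elems S′)
          ≡⟨ ≡.cong (map ψgen) (≡.trans (elems-++⊥ (⊤ {n₁} ++ (C′ - ε₀))) (≡.cong (map (_↑ˡ 1)) (elems-++ (⊤ {n₁}) (C′ - ε₀)))) ⟩
        map ψgen (map (_↑ˡ 1) (map (_↑ˡ m) (elems (⊤ {n₁})) ++ₗ map (n₁ ↑ʳ_) (elems (C′ - ε₀))))
          ≡⟨ ≡.trans (≡.sym (map-∘ _)) (map-++ _ (map (_↑ˡ m) (elems (⊤ {n₁}))) _) ⟩
        map (ψgen ∘ (_↑ˡ 1)) (map (_↑ˡ m) (elems (⊤ {n₁}))) ++ₗ map (ψgen ∘ (_↑ˡ 1)) (map (n₁ ↑ʳ_) (elems (C′ - ε₀)))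
          ≡⟨ ≡.cong₂ _++ₗ_ (≡.trans (≡.sym (map-∘ (elems (⊤ {n₁})))) (≡.trans (map-cong ψgen-class (elems (⊤ {n₁}))) (map-∘ (elems (⊤ {n₁})))))
                           (≡.trans (≡.sym (map-∘ (elems (C′ - ε₀)))) (map-cong ψgen-E₀ (elems (C′ - ε₀)))) ⟩
        map (_+Λ c₀) bs ++ₗ map (λ ε → e (n ↑ʳ ε)) (elems (C′ - ε₀)) ∎
        where open ≡.≡-Reasoning

      ψ̂-∂≋∂PQ : extend ψgen (∂ (elems S′)) ≋ ∂Λ (P *Λ Q)
      ψ̂-∂≋∂PQ = begin
        extend ψgen (∂ (elems S′))      ≈⟨ extend-∂ ψgen ψgen-Affine (elems S′) ⟩
        ∂Λ (∏ (map ψgen (elems S′)))    ≡⟨ ≡.cong (∂Λ ∘ ∏) ψgen-S′ ⟩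
        ∂Λ (∏ (map (_+Λ c₀) bs ++ₗ map (λ ε → e (n ↑ʳ ε)) (elems (C′ - ε₀)))) ≈⟨ ∂Λ-cong (∏-++ (map (_+Λ c₀) bs) _) ⟩
        ∂Λ (P *Λ Q)                     ∎
        where open ≋-Reasoning

      Q-c₀∂Q∈I : InI CM (Q -Λ c₀ *Λ ∂Λ Q)
      Q-c₀∂Q∈I = InI-≈± (begin
        Q -Λ c₀ *Λ ∂Λ Q                                   ≈⟨ ≋⇒≈± (∂Λ-Affine-* (Affine-e (n ↑ʳ ε₀)) Q) ⟨
        ∂Λ (c₀ *Λ Q)                                      ≈⟨ ∂Λ-≈± (∏-remove (e ∘ (n ↑ʳ_)) (DegreeOne-e ∘ (n ↑ʳ_)) C′ ε₀∈C′) ⟨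
        ∂Λ (∏ (map (e ∘ (n ↑ʳ_)) (elems C′)))             ≡⟨ ≡.cong (∂Λ ∘ ∏) (≡.trans (map-∘ (elems C′)) (≡.cong (map e) (≡.sym (elems-⊥++ C′)))) ⟩
        ∂Λ (∏ (map e (elems (⊥ {n} ++ C′))))              ∎) (InI-circuit (⊥ {n} ++ C′) (inj₂ (C′ , CC′ , ≡.refl)))
        where open ≈±-Reasoning

      PQ∈I : InI CM (P *Λ Q)
      PQ∈I = InI-≋ (sym split) (add (mulˡ P Q-c₀∂Q∈I) (mulʳ (∂Λ Q) (mulʳ c₀ B∈I)))
        where
        open ≋-Reasoning
        split : P *Λ Q ≋ P *Λ (Q -Λ c₀ *Λ ∂Λ Q) +Λ (B *Λ c₀) *Λ ∂Λ Q
        split = begin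
          P *Λ Q                                              ≈⟨ solve v₀ ((v₀ ⊖ v₁) ⊕ v₁) (P *Λ Q ∷ᵥ P *Λ (c₀ *Λ ∂Λ Q) ∷ᵥ []ᵥ) ⟩
          (P *Λ Q -Λ P *Λ (c₀ *Λ ∂Λ Q)) +Λ P *Λ (c₀ *Λ ∂Λ Q)  ≈⟨ +-cong (x[y-z]≈xy-xz P Q _) (*-assoc P c₀ (∂Λ Q)) ⟨
          P *Λ (Q -Λ c₀ *Λ ∂Λ Q) +Λ (P *Λ c₀) *Λ ∂Λ Q         ≈⟨ +-congˡ (*-congʳ (∏-translate-* (DegreeOne-e (n ↑ʳ ε₀)) bs)) ⟩
          P *Λ (Q -Λ c₀ *Λ ∂Λ Q) +Λ (B *Λ c₀) *Λ ∂Λ Q         ∎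

    ψ̂-circuits : ∀ S → CM′ S → InI CM (extend ψgen (∂ (elems S)))
    ψ̂-circuits _ (_ , inj₁ (_ , ≡.refl , ≡.refl) , ≡.refl) =
      subst ψ̂-class-circuit (≡.sym (image-cls-⊤ ε₀)) ψ̂-Cₙ
    ψ̂-circuits _ (_ , inj₂ (inj₁ (C , CC , ≡.refl)) , ≡.refl) =
      subst ψ̂-class-circuit (≡.sym (image-cls-⊥ ε₀ C)) (ψ̂-E₀ C CC)
    ψ̂-circuits _ (_ , inj₂ (inj₂ (_ , C′ , ≡.refl , _ , CC′ , ε₀∈C′ , ≡.refl)) , ≡.refl) =
      subst ψ̂-class-circuit (≡.sym (image-cls-remove1 ε₀ (C′ - ε₀))) (ψ̂-joined C′ CC′ ε₀∈C′)

    isIsoOS : IsIsoOS CM CM′ (φ̂ {n} {m} ε₀)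
    isIsoOS = IsIsoOS-extend φ̂gen′ ψgen (proj₁ ∘ φ̂gen-Affine) (proj₁ ∘ ψgen-Affine)
                             ψ̂∘φ̂≋id φ̂∘ψ̂≋id φ̂-circuits ψ̂-circuits

corollary4p6 : ∀ {c ℓ} (K : CommutativeRing c ℓ) (n m : ℕ) → 3 ≤ n →
    (M₀ : SimpleMatroid m) (ε₀ : Fin m) →
    Exterior.IsIsoOS K (MCircuit n M₀) (M′Circuit n M₀ ε₀) (Exterior.φ̂ K {n} {m} ε₀)
corollary4p6 K _ m (s≤s _) M₀ ε₀ = ParallelConnection.Circuits.isIsoOS K ε₀ M₀
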